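{- Let $k,r\ge 1$ be natural numbers and $\gamma\ge 1$ an ordinal. If $f$ is a monotone unary function belonging to $\mathfrak{F}_\gamma$ with $f(x)\ge\max(1,x)$ for all $x$, then the function $M_{r\times\{k\},f}$ belongs to $\mathfrak{F}_{\gamma+k-1}$.
   Context: Given $f:\mathbb{N}\to\mathbb{N}$, let $N_k(t)=k\cdot(f(t)-1)$. A type is a finite multiset of naturals; for $k\in\tau$ put $\tau_{\langle k,t\rangle}=\tau-\{k\}+N_k(t)\times\{k-1\}$ (multiset operations; $p\times\{m\}$ is $m$ with multiplicity $p$; for $k=0$ it is $\tau-\{0\}$). Define $M_{\tau,f}(t)=\max_{k\in\tau}\{1+M_{\tau_{\langle k,t\rangle},f}(t+1)\}$ with $\max\emptyset=0$ (well-founded recursion on the multiset ordering). $r\times\{k\}$ is the multiset containing $k$ with multiplicity $r$. Fast Growing Hierarchy: $F_0(x)=x+1$, $F_{n+1}(x)=F_n^{x+1}(x)$ ($g^p$ is $p$-fold iteration), extended to ordinals in the standard (Löb–Wainer) way with $F_{\alpha+1}(x)=F_\alpha^{x+1}(x)$; $\mathfrak{F}_\alpha$ is the closure of the constant zero, addition, projections and the functions $F_\beta$ for $\beta\le\alpha$ under substitution and limited primitive recursion. -}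

module Defs where

open import Data.Nat using (ℕ; zero; suc; _+_; _*_; _∸_; _≤_; _⊔_)
open import Data.Nat.Properties using ()
open import Data.List using (List; []; _∷_; map; replicate; _++_; foldr)
open import Data.List.Relation.Binary.Pointwise using (Pointwise)
open import Data.Vec using (Vec; lookup; head) renaming (_∷_ to _∷ᵥ_)
open import Data.Fin using (Fin) renaming (zero to fz; suc to fs)
open import Data.Product using (_×_; _,_; Σ)
open import Data.Unit using (⊤)
open import Relation.Binary.PropositionalEquality using (_≡_; _≢_)

-- Ordinals below ε₀ in Cantor normal form.
-- 'zero' is 0 and  'ω^ a + b'  is  ω^a + b.

data Ord : Set where
  𝟎    : Ord
  ω^_+_ : Ord → Ord → Ord

data Cmp : Set where
  lt eq gt : Cmp

cmp : Ord → Ord → Cmp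
cmp 𝟎 𝟎 = eq
cmp 𝟎 (ω^ _ + _) = lt
cmp (ω^ _ + _) 𝟎 = gt
cmp (ω^ a + b) (ω^ c + d) with cmp a c
... | lt = lt
... | gt = gt
... | eq = cmp b d

_≤o_ : Ord → Ord → Set
a ≤o b = cmp a b ≢ gt

HeadLe : Ord → Ord → Set
HeadLe 𝟎 a = ⊤
HeadLe (ω^ c + d) a = c ≤o a

data CNF : Ord → Set where
  cnf𝟎 : CNF 𝟎
  cnfω : ∀ {a b} → CNF a → CNF b → HeadLe b a → CNF (ω^ a + b)

suc-o : Ord → Ord
suc-o 𝟎 = ω^ 𝟎 + 𝟎
suc-o (ω^ a + b) = ω^ a + suc-o b

_+ℕ_ : Ord → ℕ → Ord
α +ℕ zero = α
α +ℕ suc n = suc-o (α +ℕ n)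

reps : Ord → ℕ → Ord
reps c zero = 𝟎
reps c (suc n) = ω^ c + reps c n

-- Standard fundamental sequences (Löb–Wainer / Schmitz convention):
--   (γ + ω^(β+1))_x = γ + ω^β · (x+1),   (γ + ω^λ)_x = γ + ω^(λ_x).

data Kind : Set where
  isZero : Kind
  isSucc : Ord → Kind
  isLim  : (ℕ → Ord) → Kind

view : Ord → Kind
view 𝟎 = isZero
view (ω^ a + 𝟎) with view a
... | isZero   = isSucc 𝟎
... | isSucc a' = isLim (λ x → reps a' (suc x))
... | isLim g  = isLim (λ x → ω^ (g x) + 𝟎)
view (ω^ a + (ω^ c + d)) with view (ω^ c + d)
... | isZero   = isZero
... | isSucc β = isSucc (ω^ a + β)
... | isLim g  = isLim (λ x → ω^ a + (g x))

-- Fast growing hierarchy, as its graph:  FG α x y  means  F_α(x) = y.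
--   F_0(x) = x+1,  F_{α+1}(x) = F_α^{x+1}(x),  F_λ(x) = F_{λ_x}(x).

data FG : Ord → ℕ → ℕ → Set
data Iter (β : Ord) : ℕ → ℕ → ℕ → Set

data FG where
  F-zero : ∀ {α x} → view α ≡ isZero → FG α x (suc x)
  F-succ : ∀ {α β x y} → view α ≡ isSucc β → Iter β (suc x) x y → FG α x y
  F-lim  : ∀ {α g x y} → view α ≡ isLim g → FG (g x) x y → FG α x y

data Iter β where
  it-zero : ∀ {x} → Iter β zero x x
  it-suc  : ∀ {n x z y} → FG β x z → Iter β n z y → Iter β (suc n) x y

-- The class 𝔉_α of functions ℕ^n → ℕ: closure of constant zero,
-- addition, projections and F_β (β ≤ α) under substitution and limited
-- primitive recursion (taken up to extensional equality).

data InF (α : Ord) : (n : ℕ) → (Vec ℕ n → ℕ) → Set where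
  F-const0 : ∀ {n} → InF α n (λ _ → 0)
  F-add    : InF α 2 (λ v → lookup v fz + lookup v (fs fz))
  F-proj   : ∀ {n} (i : Fin n) → InF α n (λ v → lookup v i)
  F-fast   : ∀ {β} → CNF β → β ≤o α → (h : ℕ → ℕ) → (∀ x → FG β x (h x)) →
             InF α 1 (λ v → h (head v))
  F-subst  : ∀ {m n} {g : Vec ℕ m → ℕ} {hs : Fin m → Vec ℕ n → ℕ} →
             InF α m g → (∀ i → InF α n (hs i)) →
             InF α n (λ v → g (Data.Vec.tabulate (λ i → hs i v)))
  F-lrec   : ∀ {n} {g : Vec ℕ n → ℕ} {k : Vec ℕ (suc (suc n)) → ℕ}
               {b : Vec ℕ (suc n) → ℕ} (h : Vec ℕ (suc n) → ℕ) →
             InF α n g → InF α (suc (suc n)) k → InF α (suc n) b →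
             (∀ v → h (0 ∷ᵥ v) ≡ g v) →
             (∀ y v → h (suc y ∷ᵥ v) ≡ k (y ∷ᵥ h (y ∷ᵥ v) ∷ᵥ v)) →
             (∀ w → h w ≤ b w) →
             InF α (suc n) h
  F-ext    : ∀ {n} {g g' : Vec ℕ n → ℕ} → InF α n g → (∀ v → g v ≡ g' v) →
             InF α n g'

-- Types (finite multisets of naturals, represented as lists) and M_{τ,f}.

picks : List ℕ → List (ℕ × List ℕ)
picks [] = []
picks (x ∷ xs) = (x , xs) ∷ map (λ p → (Data.Product.proj₁ p , x ∷ Data.Product.proj₂ p)) (picks xs)

N : (ℕ → ℕ) → ℕ → ℕ → ℕ
N f k t = k * (f t ∸ 1)

-- τ_{⟨k,t⟩} given τ - {k} = rest  (for k = 0, N f 0 t = 0 so this is τ - {0})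
stepType : (ℕ → ℕ) → ℕ → List ℕ → ℕ → List ℕ
stepType f k rest t = rest ++ replicate (N f k t) (k ∸ 1)

maxList : List ℕ → ℕ
maxList = foldr _⊔_ 0

-- MG f τ t m  means  M_{τ,f}(t) = m
data MG (f : ℕ → ℕ) : List ℕ → ℕ → ℕ → Set where
  M-def : ∀ {τ t} (vs : List ℕ) →
          Pointwise (λ p v → MG f (stepType f (Data.Product.proj₁ p) (Data.Product.proj₂ p) t) (suc t) v)
                    (picks τ) vs →
          MG f τ t (maxList (map suc vs))

module Submission where

-- Write H 0 t = t + 1 and H (k+1) t = (H k)^{N_{k+1}(t)} (t + 1);
-- H k t is the end time of the longest game on {k} started at time t.
-- An exchange argument shows that playing a *smallest* element first is
-- always optimal, so the longest game on a type with multiplicities c is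
-- the greedy one, ending at H_K^{c K} (… (H_0^{c 0} t)).  For r × {k} this
-- gives M_{r×{k},f}(t) = (H k)^r(t) ∸ t.  It remains to show H (j+1) ∈ 𝔉_{γ+j}:
-- H 1 is built from f by + and ∸, and H (j+2) iterates H (j+1), which is a
-- limited recursion once the iterates are bounded by F_{γ+j+1}.  That bound
-- comes from majorising every member of 𝔉_γ by an iterate of F_γ, which
-- rests on the standard facts about the fast growing hierarchy: F_α is
-- total, inflationary and monotone, and F_β(x) ≤ F_γ(x + norm β) for β ≤ γ,
-- proved by descending along fundamental sequences (Bachmann property).

open import Defs
open import Algebra.Properties.CommutativeSemigroup using (x∙yz≈y∙xz)
open import Data.Empty using (⊥; ⊥-elim)
open import Data.Fin using (Fin) renaming (zero to fz; suc to fs)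
open import Data.List using (List; []; _∷_; map; replicate; _++_)
open import Data.List.Relation.Binary.Pointwise using (Pointwise; []; _∷_)
open import Data.List.Relation.Unary.All using (All; []; _∷_)
open import Data.List.Relation.Unary.All.Properties using ()
  renaming (map⁺ to All-map⁺; ++⁺ to All-++⁺; replicate⁺ to All-replicate⁺)
open import Data.List.Relation.Unary.Any using (Any; here; there)
open import Data.List.Relation.Unary.Any.Properties using () renaming (map⁺ to Any-map⁺)
open import Data.Nat using (ℕ; zero; suc; _+_; _*_; _∸_; _≤_; _<_; _⊔_; z≤n; s≤s; pred; _≤′_; ≤′-refl; ≤′-step; >-nonZero)
open import Data.Nat.GeneralisedArithmetic using (fold; fold-+; +-is-fold)
open import Data.Nat.Properties
open import Data.Product using (_×_; _,_; Σ; proj₁; proj₂)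
open import Data.Sum using (_⊎_; inj₁; inj₂)
open import Data.Unit using (tt)
open import Data.Vec using (Vec; []; lookup; head; tabulate) renaming (_∷_ to _∷ᵥ_)
open import Induction.WellFounded using (Acc; acc; WellFounded)
open import Relation.Nullary using (Dec; yes; no)
open import Relation.Binary.PropositionalEquality

_<o_ : Ord → Ord → Set
a <o b = cmp a b ≡ lt

cmp-refl : ∀ a → cmp a a ≡ eq
cmp-refl 𝟎 = refl
cmp-refl (ω^ a + b) rewrite cmp-refl a = cmp-refl b

cmp≡eq⇒≡ : ∀ a b → cmp a b ≡ eq → a ≡ b
cmp≡eq⇒≡ 𝟎 𝟎 e = refl
cmp≡eq⇒≡ (ω^ a + b) (ω^ c + d) e with cmp a c in e₁
cmp≡eq⇒≡ (ω^ a + b) (ω^ c + d) () | lt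
cmp≡eq⇒≡ (ω^ a + b) (ω^ c + d) () | gt
... | eq rewrite cmp≡eq⇒≡ a c e₁ | cmp≡eq⇒≡ b d e = refl

<o-head : ∀ a c b d → a <o c → (ω^ a + b) <o (ω^ c + d)
<o-head a c b d e rewrite e = refl

cmp-same-head : ∀ a b d → cmp (ω^ a + b) (ω^ a + d) ≡ cmp b d
cmp-same-head a b d rewrite cmp-refl a = refl

<o-trans : ∀ a b c → a <o b → b <o c → a <o c
<o-trans 𝟎 (ω^ _ + _) (ω^ _ + _) p q = refl
<o-trans (ω^ a + b) (ω^ c + d) (ω^ e + f) p q with cmp a c in e₁ | cmp c e in e₂
... | lt | lt = <o-head a e b f (<o-trans a c e e₁ e₂)
... | lt | eq rewrite cmp≡eq⇒≡ c e e₂ = <o-head a e b f e₁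
... | eq | lt rewrite cmp≡eq⇒≡ a c e₁ = <o-head c e b f e₂
... | eq | eq rewrite cmp≡eq⇒≡ a c e₁ | cmp≡eq⇒≡ c e e₂ | cmp-refl e = <o-trans b d f p q

≮o𝟎 : ∀ a → a <o 𝟎 → ⊥
≮o𝟎 𝟎 ()
≮o𝟎 (ω^ _ + _) ()

≤o-cases : ∀ a b → a ≤o b → a <o b ⊎ a ≡ b
≤o-cases a b p with cmp a b in e
... | lt = inj₁ refl
... | eq = inj₂ (cmp≡eq⇒≡ a b e)
... | gt = ⊥-elim (p refl)

<o⇒≤o : ∀ a b → a <o b → a ≤o b
<o⇒≤o a b e q with trans (sym e) q
... | ()

≤o-refl : ∀ a → a ≤o a
≤o-refl a q with trans (sym (cmp-refl a)) q
... | ()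

≤o-trans : ∀ a b c → a ≤o b → b ≤o c → a ≤o c
≤o-trans a b c p q with ≤o-cases a b p | ≤o-cases b c q
... | inj₂ refl | _ = q
... | inj₁ _ | inj₂ refl = p
... | inj₁ x | inj₁ y = <o⇒≤o a c (<o-trans a b c x y)

𝟎≤o : ∀ a → 𝟎 ≤o a
𝟎≤o 𝟎 ()
𝟎≤o (ω^ _ + _) ()

view-suc-o : ∀ a → view (suc-o a) ≡ isSucc a
view-suc-o 𝟎 = refl
view-suc-o (ω^ a + b) with suc-o b in e
... | 𝟎 = ⊥-elim (suc-o≢𝟎 b e)
  where suc-o≢𝟎 : ∀ b → suc-o b ≡ 𝟎 → ⊥
        suc-o≢𝟎 𝟎 ()
        suc-o≢𝟎 (ω^ _ + _) ()
... | ω^ c + d rewrite sym e | view-suc-o b = refl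

<o-suc-o : ∀ a → a <o suc-o a
<o-suc-o 𝟎 = refl
<o-suc-o (ω^ a + b) rewrite cmp-refl a = <o-suc-o b

<o-suc-o⇒≤o : ∀ c a → c <o suc-o a → c ≤o a
<o-suc-o⇒≤o 𝟎 a p = 𝟎≤o a
<o-suc-o⇒≤o (ω^ c + d) 𝟎 p with cmp c 𝟎 in e
... | lt = ⊥-elim (≮o𝟎 c e)
... | eq = ⊥-elim (≮o𝟎 d p)
<o-suc-o⇒≤o (ω^ c + d) 𝟎 () | gt
<o-suc-o⇒≤o (ω^ c + d) (ω^ a + b) p with cmp c a in e
... | lt = λ ()
<o-suc-o⇒≤o (ω^ c + d) (ω^ a + b) () | gt
... | eq = <o-suc-o⇒≤o d b p

view≡isZero⇒𝟎 : ∀ α → view α ≡ isZero → α ≡ 𝟎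
view≡isZero⇒𝟎 𝟎 e = refl
view≡isZero⇒𝟎 (ω^ a + 𝟎) e with view a
view≡isZero⇒𝟎 (ω^ a + 𝟎) () | isZero
view≡isZero⇒𝟎 (ω^ a + 𝟎) () | isSucc _
view≡isZero⇒𝟎 (ω^ a + 𝟎) () | isLim _
view≡isZero⇒𝟎 (ω^ a + (ω^ c + d)) e with view (ω^ c + d) | view≡isZero⇒𝟎 (ω^ c + d)
... | isZero | tail≡𝟎 with tail≡𝟎 refl
... | ()
view≡isZero⇒𝟎 (ω^ a + (ω^ c + d)) () | isSucc _ | _
view≡isZero⇒𝟎 (ω^ a + (ω^ c + d)) () | isLim _ | _

view≡isSucc⇒suc-o : ∀ α β → view α ≡ isSucc β → α ≡ suc-o β
view≡isSucc⇒suc-o (ω^ a + 𝟎) β e with view a in e₂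
view≡isSucc⇒suc-o (ω^ a + 𝟎) β refl | isZero rewrite view≡isZero⇒𝟎 a e₂ = refl
view≡isSucc⇒suc-o (ω^ a + 𝟎) β () | isSucc _
view≡isSucc⇒suc-o (ω^ a + 𝟎) β () | isLim _
view≡isSucc⇒suc-o (ω^ a + (ω^ c + d)) β e with view (ω^ c + d) | view≡isSucc⇒suc-o (ω^ c + d)
view≡isSucc⇒suc-o (ω^ a + (ω^ c + d)) β () | isZero | _
view≡isSucc⇒suc-o (ω^ a + (ω^ c + d)) .(ω^ a + β') refl | isSucc β' | r rewrite r β' refl = refl
view≡isSucc⇒suc-o (ω^ a + (ω^ c + d)) β () | isLim _ | _

fundamental-<o : ∀ α g x → view α ≡ isLim g → g x <o α
fundamental-<o (ω^ a + 𝟎) g x e with view a in e₂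
fundamental-<o (ω^ a + 𝟎) g x () | isZero
fundamental-<o (ω^ a + 𝟎) g x refl | isSucc a' rewrite view≡isSucc⇒suc-o a a' e₂ =
  <o-head a' (suc-o a') _ 𝟎 (<o-suc-o a')
fundamental-<o (ω^ a + 𝟎) g x refl | isLim g' = <o-head (g' x) a 𝟎 𝟎 (fundamental-<o a g' x e₂)
fundamental-<o (ω^ a + (ω^ c + d)) g x e with view (ω^ c + d) | fundamental-<o (ω^ c + d)
fundamental-<o (ω^ a + (ω^ c + d)) g x () | isZero | _
fundamental-<o (ω^ a + (ω^ c + d)) g x () | isSucc _ | _
fundamental-<o (ω^ a + (ω^ c + d)) g x refl | isLim g' | r =
  trans (cmp-same-head a (g' x) (ω^ c + d)) (r g' x refl)

cnf-suc-o : ∀ {a} → CNF a → CNF (suc-o a)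
cnf-suc-o cnf𝟎 = cnfω cnf𝟎 cnf𝟎 tt
cnf-suc-o {ω^ a + 𝟎} (cnfω ca cb h) = cnfω ca (cnf-suc-o cb) (λ q → 𝟎≤o a q)
cnf-suc-o {ω^ a + (ω^ c + d)} (cnfω ca cb h) = cnfω ca (cnf-suc-o cb) h

cnf-+ℕ : ∀ {γ} → CNF γ → ∀ j → CNF (γ +ℕ j)
cnf-+ℕ cγ zero = cγ
cnf-+ℕ cγ (suc j) = cnf-suc-o (cnf-+ℕ cγ j)

cnf-reps : ∀ {a} n → CNF a → CNF (reps a n)
cnf-reps zero ca = cnf𝟎
cnf-reps (suc zero) ca = cnfω ca cnf𝟎 tt
cnf-reps {a} (suc (suc n)) ca = cnfω ca (cnf-reps (suc n) ca) (≤o-refl a)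

cnf-pred : ∀ {α β} → CNF α → view α ≡ isSucc β → CNF β
cnf-pred {α} {β} c e rewrite view≡isSucc⇒suc-o α β e = go c
  where go : ∀ {β} → CNF (suc-o β) → CNF β
        go {𝟎} _ = cnf𝟎
        go {ω^ a + 𝟎} (cnfω ca cb h) = cnfω ca cnf𝟎 tt
        go {ω^ a + (ω^ c + d)} (cnfω ca cb h) = cnfω ca (go cb) h

HeadLe-fundamental : ∀ α g x a → view α ≡ isLim g → HeadLe α a → HeadLe (g x) a
HeadLe-fundamental (ω^ c + 𝟎) g x a e h with view c in e₂
HeadLe-fundamental (ω^ c + 𝟎) g x a () h | isZero
HeadLe-fundamental (ω^ c + 𝟎) g x a refl h | isSucc c' rewrite view≡isSucc⇒suc-o c c' e₂ =
  ≤o-trans c' (suc-o c') a (<o⇒≤o c' (suc-o c') (<o-suc-o c')) h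
HeadLe-fundamental (ω^ c + 𝟎) g x a refl h | isLim g' =
  ≤o-trans (g' x) c a (<o⇒≤o (g' x) c (fundamental-<o c g' x e₂)) h
HeadLe-fundamental (ω^ c + (ω^ c' + d)) g x a e h with view (ω^ c' + d)
HeadLe-fundamental (ω^ c + (ω^ c' + d)) g x a () h | isZero
HeadLe-fundamental (ω^ c + (ω^ c' + d)) g x a () h | isSucc _
HeadLe-fundamental (ω^ c + (ω^ c' + d)) g x a refl h | isLim g' = h

cnf-fundamental : ∀ α g x → CNF α → view α ≡ isLim g → CNF (g x)
cnf-fundamental (ω^ a + 𝟎) g x c e with view a in e₂
cnf-fundamental (ω^ a + 𝟎) g x c () | isZero
cnf-fundamental (ω^ a + 𝟎) g x (cnfω ca _ _) refl | isSucc a' = cnf-reps (suc x) (cnf-pred ca e₂)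
cnf-fundamental (ω^ a + 𝟎) g x (cnfω ca _ _) refl | isLim g' =
  cnfω (cnf-fundamental a g' x ca e₂) cnf𝟎 tt
cnf-fundamental (ω^ a + (ω^ c + d)) g x cc e
  with view (ω^ c + d) | cnf-fundamental (ω^ c + d) | HeadLe-fundamental (ω^ c + d)
cnf-fundamental (ω^ a + (ω^ c + d)) g x cc () | isZero | _ | _
cnf-fundamental (ω^ a + (ω^ c + d)) g x cc () | isSucc _ | _ | _
cnf-fundamental (ω^ a + (ω^ c + d)) g x (cnfω ca cb h) refl | isLim g' | r | r₂ =
  cnfω ca (r g' x cb refl) (r₂ g' x a refl h)

data Step (x : ℕ) : Ord → Ord → Set where
  pred-step : ∀ {α β} → view α ≡ isSucc β → Step x α β
  fund-step : ∀ {α g} → view α ≡ isLim g → Step x α (g x)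

infixr 5 _∷d_ _++d_

data Descent (x : ℕ) : Ord → Ord → Set where
  done : ∀ {α} → Descent x α α
  _∷d_ : ∀ {α β γ} → Step x α β → Descent x β γ → Descent x α γ

_++d_ : ∀ {x α β γ} → Descent x α β → Descent x β γ → Descent x α γ
done ++d q = q
(s ∷d p) ++d q = s ∷d (p ++d q)

_◁_ : Ord → Ord → Set
β ◁ α = Σ ℕ λ x → Step x α β

no-step-from-𝟎 : ∀ {x β} → Step x 𝟎 β → ⊥
no-step-from-𝟎 (pred-step ())
no-step-from-𝟎 (fund-step ())

step-in-tail : ∀ x a c d β → Step x (ω^ a + (ω^ c + d)) β →
  Σ Ord (λ b' → Step x (ω^ c + d) b' × β ≡ ω^ a + b')
step-in-tail x a c d β (pred-step e) with view (ω^ c + d) in e₂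
step-in-tail x a c d β (pred-step ()) | isZero
step-in-tail x a c d .(ω^ a + β') (pred-step refl) | isSucc β' = β' , pred-step e₂ , refl
step-in-tail x a c d β (pred-step ()) | isLim _
step-in-tail x a c d β (fund-step e) with view (ω^ c + d) in e₂
step-in-tail x a c d β (fund-step ()) | isZero
step-in-tail x a c d β (fund-step ()) | isSucc _
step-in-tail x a c d .(ω^ a + g' x) (fund-step refl) | isLim g' = g' x , fund-step e₂ , refl

step-lift : ∀ x a b b' → Step x b b' → Step x (ω^ a + b) (ω^ a + b')
step-lift x a 𝟎 b' s = ⊥-elim (no-step-from-𝟎 s)
step-lift x a (ω^ c + d) b' (pred-step e) = pred-step (lift e)
  where lift : view (ω^ c + d) ≡ isSucc b' → view (ω^ a + (ω^ c + d)) ≡ isSucc (ω^ a + b')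
        lift e rewrite e = refl
step-lift x a (ω^ c + d) .(g x) (fund-step {g = g} e) = fund-step {g = λ y → ω^ a + g y} (lift e)
  where lift : view (ω^ c + d) ≡ isLim g → view (ω^ a + (ω^ c + d)) ≡ isLim (λ y → ω^ a + g y)
        lift e rewrite e = refl

descent-lift : ∀ x a {b b'} → Descent x b b' → Descent x (ω^ a + b) (ω^ a + b')
descent-lift x a done = done
descent-lift x a (s ∷d p) = step-lift x a _ _ s ∷d descent-lift x a p

-- Every descent terminates: ◁ is well founded.  Accessibility of ω^a + b is
-- obtained from that of ω^a and of b, and accessibility of ω^a from that of a.
acc-𝟎 : Acc _◁_ 𝟎
acc-𝟎 = acc λ (_ , s) → ⊥-elim (no-step-from-𝟎 s)

acc-tail : ∀ a → Acc _◁_ (ω^ a + 𝟎) → ∀ b → Acc _◁_ b → Acc _◁_ (ω^ a + b)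
acc-tail a q 𝟎 _ = q
acc-tail a q (ω^ c + d) (acc rs) = acc λ (x , s) → go x (step-in-tail x a c d _ s)
  where go : ∀ x {β} → Σ Ord (λ b' → Step x (ω^ c + d) b' × β ≡ ω^ a + b') → Acc _◁_ β
        go x (b' , s' , refl) = acc-tail a q b' (rs (x , s'))

acc-reps : ∀ a → Acc _◁_ (ω^ a + 𝟎) → ∀ n → Acc _◁_ (reps a n)
acc-reps a q zero = acc-𝟎
acc-reps a q (suc n) = acc-tail a q (reps a n) (acc-reps a q n)

acc-power : ∀ a → Acc _◁_ a → Acc _◁_ (ω^ a + 𝟎)
acc-power a (acc rs) = acc λ (x , s) → go x s
  where
  go : ∀ x {β} → Step x (ω^ a + 𝟎) β → Acc _◁_ β
  go x (pred-step e) with view a in e₂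
  go x (pred-step refl) | isZero = acc-𝟎
  go x (pred-step ()) | isSucc _
  go x (pred-step ()) | isLim _
  go x (fund-step e) with view a in e₂
  go x (fund-step ()) | isZero
  go x (fund-step refl) | isSucc a' = acc-reps a' (acc-power a' (rs (x , pred-step e₂))) (suc x)
  go x (fund-step refl) | isLim g' = acc-power (g' x) (rs (x , fund-step e₂))

◁-wellFounded : WellFounded _◁_
◁-wellFounded 𝟎 = acc-𝟎
◁-wellFounded (ω^ a + b) = acc-tail a (acc-power a (◁-wellFounded a)) b (◁-wellFounded b)

descent-to-𝟎 : ∀ x α → Descent x α 𝟎
descent-to-𝟎 x α = go α (◁-wellFounded α)
  where
  go : ∀ α → Acc _◁_ α → Descent x α 𝟎
  go α (acc rs) with view α in e
  ... | isZero rewrite view≡isZero⇒𝟎 α e = done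
  ... | isSucc β = pred-step e ∷d go β (rs (x , pred-step e))
  ... | isLim g = fund-step e ∷d go (g x) (rs (x , fund-step e))

descent-power : ∀ x {c c'} → Descent x c c' → Descent x (ω^ c + 𝟎) (ω^ c' + 𝟎)
descent-power x done = done
descent-power x {c} (pred-step {β = c'} e ∷d p) =
  (fund-step {g = λ y → reps c' (suc y)} (lift e) ∷d descent-lift x c' (descent-to-𝟎 x (reps c' x)))
  ++d descent-power x p
  where lift : view c ≡ isSucc c' → view (ω^ c + 𝟎) ≡ isLim (λ y → reps c' (suc y))
        lift e rewrite e = refl
descent-power x {c} (fund-step {g = g} e ∷d p) =
  fund-step {g = λ y → ω^ g y + 𝟎} (lift e) ∷d descent-power x p
  where lift : view c ≡ isLim g → view (ω^ c + 𝟎) ≡ isLim (λ y → ω^ g y + 𝟎)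
        lift e rewrite e = refl

descent-reps : ∀ x a n → Descent x (reps a (suc n)) (reps a n)
descent-reps x a zero = descent-to-𝟎 x (ω^ a + 𝟎)
descent-reps x a (suc n) = descent-lift x a (descent-reps x a n)

bachmann : ∀ λ' g x → view λ' ≡ isLim g → Descent x (g (suc x)) (g x)
bachmann (ω^ a + 𝟎) g x e with view a | bachmann a
bachmann (ω^ a + 𝟎) g x () | isZero | _
bachmann (ω^ a + 𝟎) g x refl | isSucc a' | _ = descent-reps x a' (suc x)
bachmann (ω^ a + 𝟎) g x refl | isLim g' | r = descent-power x (r g' x refl)
bachmann (ω^ a + (ω^ c + d)) g x e with view (ω^ c + d) | bachmann (ω^ c + d)
bachmann (ω^ a + (ω^ c + d)) g x () | isZero | _
bachmann (ω^ a + (ω^ c + d)) g x () | isSucc _ | _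
bachmann (ω^ a + (ω^ c + d)) g x refl | isLim g' | r = descent-lift x a (r g' x refl)

-- By the Bachmann property an x-th descent can be replayed as an (x+1)-th one,
-- so larger arguments see more of the fundamental sequence.
descent-suc : ∀ {x α β} → Descent x α β → Descent (suc x) α β
descent-suc {x} {α} = go α (◁-wellFounded α)
  where
  go : ∀ α {β} → Acc _◁_ α → Descent x α β → Descent (suc x) α β
  go α _ done = done
  go α (acc rs) (pred-step e ∷d p) = pred-step e ∷d go _ (rs (x , pred-step e)) p
  go α (acc rs) (fund-step {g = g} e ∷d p) =
    fund-step e ∷d (go (g (suc x)) (rs (suc x , fund-step e)) (bachmann α g x e)
                    ++d go (g x) (rs (x , fund-step e)) p)

fundamental-descent : ∀ λ' g x x' → view λ' ≡ isLim g → x ≤ x' → Descent x' (g x') (g x)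
fundamental-descent λ' g x x' e q = go (≤⇒≤′ q)
  where
  go : ∀ {x'} → x ≤′ x' → Descent x' (g x') (g x)
  go ≤′-refl = done
  go (≤′-step q) = descent-suc (bachmann λ' g _ e) ++d descent-suc (go q)

isZero≢isSucc : ∀ {k β} → k ≡ isZero → k ≡ isSucc β → ⊥
isZero≢isSucc refl ()

isZero≢isLim : ∀ {k g} → k ≡ isZero → k ≡ isLim g → ⊥
isZero≢isLim refl ()

isSucc≢isLim : ∀ {k β g} → k ≡ isSucc β → k ≡ isLim g → ⊥
isSucc≢isLim refl ()

isSucc-injective : ∀ {k β β'} → k ≡ isSucc β → k ≡ isSucc β' → β ≡ β'
isSucc-injective refl refl = refl

isLim-injective : ∀ {k g g'} → k ≡ isLim g → k ≡ isLim g' → g ≡ g'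
isLim-injective refl refl = refl

FG-inflationary : ∀ {α x y} → FG α x y → x < y
Iter-inflationary : ∀ {β n x y} → Iter β n x y → x ≤ y
FG-inflationary (F-zero e) = ≤-refl
FG-inflationary (F-succ e (it-suc d it)) = ≤-trans (FG-inflationary d) (Iter-inflationary it)
FG-inflationary (F-lim e d) = FG-inflationary d
Iter-inflationary it-zero = ≤-refl
Iter-inflationary (it-suc d it) = ≤-trans (<⇒≤ (FG-inflationary d)) (Iter-inflationary it)

FG-functional : ∀ {α x y y'} → FG α x y → FG α x y' → y ≡ y'
Iter-functional : ∀ {β n x y y'} → Iter β n x y → Iter β n x y' → y ≡ y'
FG-functional (F-zero e) (F-zero e') = refl
FG-functional (F-zero e) (F-succ e' _) = ⊥-elim (isZero≢isSucc e e')
FG-functional (F-zero e) (F-lim e' _) = ⊥-elim (isZero≢isLim e e')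
FG-functional (F-succ e _) (F-zero e') = ⊥-elim (isZero≢isSucc e' e)
FG-functional (F-succ e it) (F-succ e' it') with isSucc-injective e e'
... | refl = Iter-functional it it'
FG-functional (F-succ e _) (F-lim e' _) = ⊥-elim (isSucc≢isLim e e')
FG-functional (F-lim e _) (F-zero e') = ⊥-elim (isZero≢isLim e' e)
FG-functional (F-lim e _) (F-succ e' _) = ⊥-elim (isSucc≢isLim e' e)
FG-functional (F-lim e d) (F-lim e' d') with isLim-injective e e'
... | refl = FG-functional d d'
Iter-functional it-zero it-zero = refl
Iter-functional (it-suc d it) (it-suc d' it') with FG-functional d d'
... | refl = Iter-functional it it'

FG-step : ∀ {x α β y} → Step x α β → FG α x y → Σ ℕ (λ z → FG β x z × z ≤ y)
FG-step (pred-step e) (F-zero e') = ⊥-elim (isZero≢isSucc e' e)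
FG-step (pred-step e) (F-succ e' (it-suc d it)) with isSucc-injective e e'
... | refl = _ , d , Iter-inflationary it
FG-step (pred-step e) (F-lim e' _) = ⊥-elim (isSucc≢isLim e e')
FG-step (fund-step e) (F-zero e') = ⊥-elim (isZero≢isLim e' e)
FG-step (fund-step e) (F-succ e' _) = ⊥-elim (isSucc≢isLim e' e)
FG-step (fund-step e) (F-lim e' d) with isLim-injective e e'
... | refl = _ , d , ≤-refl

FG-descent : ∀ {x α β y} → Descent x α β → FG α x y → Σ ℕ (λ z → FG β x z × z ≤ y)
FG-descent done d = _ , d , ≤-refl
FG-descent (s ∷d p) d with FG-step s d
... | z , d' , q with FG-descent p d'
... | w , d'' , q' = w , d'' , ≤-trans q' q

-- F_α is monotone; at limits this uses that λ_{x'} descends to λ_x at x'.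
FG-monotone : ∀ {α x y x' y'} → FG α x y → FG α x' y' → x ≤ x' → y ≤ y'
Iter-monotone : ∀ {β n x y n' x' y'} → Iter β n x y → Iter β n' x' y' → n ≤ n' → x ≤ x' → y ≤ y'
FG-monotone (F-zero e) (F-zero e') q = s≤s q
FG-monotone (F-zero e) (F-succ e' _) q = ⊥-elim (isZero≢isSucc e e')
FG-monotone (F-zero e) (F-lim e' _) q = ⊥-elim (isZero≢isLim e e')
FG-monotone (F-succ e _) (F-zero e') q = ⊥-elim (isZero≢isSucc e' e)
FG-monotone (F-succ e it) (F-succ e' it') q with isSucc-injective e e'
... | refl = Iter-monotone it it' (s≤s q) q
FG-monotone (F-succ e _) (F-lim e' _) q = ⊥-elim (isSucc≢isLim e e')
FG-monotone (F-lim e _) (F-zero e') q = ⊥-elim (isZero≢isLim e' e)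
FG-monotone (F-lim e _) (F-succ e' _) q = ⊥-elim (isSucc≢isLim e' e)
FG-monotone {α} {x} {y} {x'} (F-lim {g = g} e d) (F-lim e' d') q with isLim-injective e e'
... | refl with FG-descent (fundamental-descent α g x x' e q) d'
... | w , dw , qw = ≤-trans (FG-monotone d dw q) qw
Iter-monotone it-zero it' n≤ q = ≤-trans q (Iter-inflationary it')
Iter-monotone (it-suc d it) (it-suc d' it') (s≤s n≤) q = Iter-monotone it it' n≤ (FG-monotone d d' q)

FG-total : ∀ α x → Σ ℕ (FG α x)
FG-total α = go α (◁-wellFounded α)
  where
  iterate : ∀ β → (∀ z → Σ ℕ (FG β z)) → ∀ n x → Σ ℕ (Iter β n x)
  iterate β F zero x = x , it-zero
  iterate β F (suc n) x with F x
  ... | z , d with iterate β F n z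
  ... | y , it = y , it-suc d it
  go : ∀ α → Acc _◁_ α → ∀ x → Σ ℕ (FG α x)
  go α (acc rs) x with view α in e
  ... | isZero = suc x , F-zero e
  ... | isSucc β with iterate β (go β (rs (x , pred-step e))) (suc x) x
  ... | y , it = y , F-succ e it
  go α (acc rs) x | isLim g with go (g x) (rs (x , fund-step e)) x
  ... | y , d = y , F-lim e d

norm : Ord → ℕ
norm 𝟎 = 0
norm (ω^ c + d) = suc (norm c ⊔ norm d)

<o-cases : ∀ c d a b → (ω^ c + d) <o (ω^ a + b) → c <o a ⊎ (c ≡ a × d <o b)
<o-cases c d a b p with cmp c a in e
... | lt = inj₁ refl
... | eq = inj₂ (cmp≡eq⇒≡ c a e , p)

<o-power : ∀ c d a → (ω^ c + d) <o (ω^ a + 𝟎) → c <o a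
<o-power c d a p with <o-cases c d a 𝟎 p
... | inj₁ q = q
... | inj₂ (_ , q) = ⊥-elim (≮o𝟎 d q)

<o-reps : ∀ a d x → CNF d → HeadLe d a → suc (norm d) ≤ x → d <o reps a x
<o-reps a 𝟎 (suc x) _ _ _ = refl
<o-reps a (ω^ e + d') (suc x) (cnfω ce cd hd) h (s≤s q) with ≤o-cases e a h
... | inj₁ lt' = <o-head e a d' (reps a x) lt'
... | inj₂ refl = trans (cmp-same-head e d' (reps e x))
                        (<o-reps e d' x cd hd (≤-trans (s≤s (m≤n⊔m (norm e) (norm d'))) q))

norm-tail≤ : ∀ c d x → norm (ω^ c + d) ≤ x → norm d ≤ x
norm-tail≤ c d x q = ≤-trans (≤-trans (m≤n⊔m (norm c) (norm d)) (n≤1+n _)) q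

norm-head≤ : ∀ c d x → norm (ω^ c + d) ≤ x → norm c ≤ x
norm-head≤ c d x q = ≤-trans (≤-trans (m≤m⊔n (norm c) (norm d)) (n≤1+n _)) q

below-fundamental : ∀ λ' g x → CNF λ' → view λ' ≡ isLim g →
  ∀ β → CNF β → β <o λ' → norm β ≤ x → β <o g x
below-fundamental (ω^ a + 𝟎) g x cl e β cb p q with view a in e₂ | below-fundamental a
below-fundamental (ω^ a + 𝟎) g x cl () β cb p q | isZero | _
below-fundamental (ω^ a + 𝟎) g x cl refl 𝟎 cb p q | isSucc a' | _ = refl
below-fundamental (ω^ a + 𝟎) g x (cnfω ca _ _) refl (ω^ c + d) (cnfω cc cd hd) p q | isSucc a' | _
  with ≤o-cases c a' (<o-suc-o⇒≤o c a' (subst (c <o_) (view≡isSucc⇒suc-o a a' e₂) (<o-power c d a p)))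
... | inj₁ lt' = <o-head c a' d (reps a' x) lt'
... | inj₂ refl = trans (cmp-same-head c d (reps c x))
                        (<o-reps c d x cd hd (≤-trans (s≤s (m≤n⊔m (norm c) (norm d))) q))
below-fundamental (ω^ a + 𝟎) g x cl refl 𝟎 cb p q | isLim g' | _ = refl
below-fundamental (ω^ a + 𝟎) g x (cnfω ca _ _) refl (ω^ c + d) (cnfω cc cd hd) p q | isLim g' | r =
  <o-head c (g' x) d 𝟎 (r g' x ca refl c cc (<o-power c d a p) (norm-head≤ c d x q))
below-fundamental (ω^ a + (ω^ c' + d')) g x cl e β cb p q
  with view (ω^ c' + d') | below-fundamental (ω^ c' + d')
below-fundamental (ω^ a + (ω^ c' + d')) g x cl () β cb p q | isZero | _
below-fundamental (ω^ a + (ω^ c' + d')) g x cl () β cb p q | isSucc _ | _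
below-fundamental (ω^ a + (ω^ c' + d')) g x cl refl 𝟎 cb p q | isLim g' | r = refl
below-fundamental (ω^ a + (ω^ c' + d')) g x (cnfω ca cb' hb) refl (ω^ c + d) (cnfω cc cd hd) p q | isLim g' | r
  with <o-cases c d a (ω^ c' + d') p
... | inj₁ lt' = <o-head c a d (g' x) lt'
... | inj₂ (refl , p') = trans (cmp-same-head c d (g' x)) (r g' x cb' refl d cd p' (norm-tail≤ c d x q))

descent-to-smaller : ∀ γ → CNF γ → ∀ β x → CNF β → β <o γ → norm β ≤ x → Descent x γ β
descent-to-smaller γ = go γ (◁-wellFounded γ)
  where
  go : ∀ γ → Acc _◁_ γ → CNF γ → ∀ β x → CNF β → β <o γ → norm β ≤ x → Descent x γ β
  go γ (acc rs) cγ β x cβ p q with view γ in e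
  ... | isZero = ⊥-elim (≮o𝟎 β (subst (β <o_) (view≡isZero⇒𝟎 γ e) p))
  ... | isSucc γ' with ≤o-cases β γ' (<o-suc-o⇒≤o β γ' (subst (β <o_) (view≡isSucc⇒suc-o γ γ' e) p))
  ... | inj₂ refl = pred-step e ∷d done
  ... | inj₁ lt' = pred-step e ∷d go γ' (rs (x , pred-step e)) (cnf-pred cγ e) β x cβ lt' q
  go γ (acc rs) cγ β x cβ p q | isLim g =
    fund-step e ∷d go (g x) (rs (x , fund-step e)) (cnf-fundamental γ g x cγ e) β x cβ
                      (below-fundamental γ g x cγ e β cβ p q) q

FG-compare : ∀ β γ x y z → CNF β → CNF γ → β ≤o γ → FG β x y → FG γ (x + norm β) z → y ≤ z
FG-compare β γ x y z cβ cγ le d d' with ≤o-cases β γ le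
... | inj₂ refl = FG-monotone d d' (m≤m+n x (norm β))
... | inj₁ lt' with FG-descent (descent-to-smaller γ cγ β (x + norm β) cβ lt' (m≤n+m (norm β) x)) d'
... | w , dw , qw = ≤-trans (FG-monotone d dw (m≤m+n x (norm β))) qw

iter : ℕ → (ℕ → ℕ) → ℕ → ℕ
iter n h x = fold x h n

Monotone : (ℕ → ℕ) → Set
Monotone h = ∀ {x y} → x ≤ y → h x ≤ h y

Inflationary : (ℕ → ℕ) → Set
Inflationary h = ∀ x → x ≤ h x

iter-comm : ∀ n h x → iter n h (h x) ≡ h (iter n h x)
iter-comm zero h x = refl
iter-comm (suc n) h x = cong h (iter-comm n h x)

iter-add : ∀ m n h x → iter (m + n) h x ≡ iter m h (iter n h x)
iter-add m n h x = fold-+ x h m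

iter-mul : ∀ m n h x → iter (m * n) h x ≡ iter m (iter n h) x
iter-mul zero n h x = refl
iter-mul (suc m) n h x = trans (iter-add n (m * n) h x) (cong (iter n h) (iter-mul m n h x))

iter-monotone : ∀ {h} → Monotone h → ∀ n → Monotone (iter n h)
iter-monotone hm zero q = q
iter-monotone hm (suc n) q = hm (iter-monotone hm n q)

iter-inflationary : ∀ {h} → Inflationary h → ∀ n → Inflationary (iter n h)
iter-inflationary he zero x = ≤-refl
iter-inflationary he (suc n) x = ≤-trans (iter-inflationary he n x) (he _)

iter-count-monotone : ∀ {h} → Inflationary h → ∀ {n m} x → n ≤ m → iter n h x ≤ iter m h x
iter-count-monotone {h} he {n} x q with m≤n⇒∃[o]m+o≡n q
... | o , refl = subst (iter n h x ≤_) (sym (trans (cong (λ z → iter z h x) (+-comm n o)) (iter-add o n h x)))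
                       (iter-inflationary he o (iter n h x))

iter-both-monotone : ∀ {h} → Monotone h → Inflationary h → ∀ {n m x y} → n ≤ m → x ≤ y →
  iter n h x ≤ iter m h y
iter-both-monotone hm he {m = m} {x} q r = ≤-trans (iter-count-monotone he x q) (iter-monotone hm m r)

iter-pointwise : ∀ {h h'} → Monotone h' → (∀ x → h x ≤ h' x) → ∀ n x → iter n h x ≤ iter n h' x
iter-pointwise hm le zero x = ≤-refl
iter-pointwise hm le (suc n) x = ≤-trans (le _) (hm (iter-pointwise hm le n x))

iter-strict : ∀ {h} → (∀ x → x < h x) → ∀ n x → n + x ≤ iter n h x
iter-strict hs zero x = ≤-refl
iter-strict hs (suc n) x = ≤-trans (s≤s (iter-strict hs n x)) (hs _)

-- Finite multisets of naturals as multiplicity functions.  inc c p n adds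
-- n copies of p, dec c p removes one copy of p.
Count : Set
Count = ℕ → ℕ

copies : ℕ → ℕ → Count
copies p n j with j ≟ p
... | yes _ = n
... | no _ = 0

copies-at : ∀ p n j → j ≡ p → copies p n j ≡ n
copies-at p n j e with j ≟ p
... | yes _ = refl
... | no j≢p = ⊥-elim (j≢p e)

copies-off : ∀ p n j → j ≢ p → copies p n j ≡ 0
copies-off p n j j≢p with j ≟ p
... | yes e = ⊥-elim (j≢p e)
... | no _ = refl

copies-+ : ∀ p m n j → copies p m j + copies p n j ≡ copies p (m + n) j
copies-+ p m n j with j ≟ p
... | yes _ = refl
... | no _ = refl

copies-mono : ∀ p {m n} → m ≤ n → ∀ j → copies p m j ≤ copies p n j
copies-mono p q j with j ≟ p
... | yes _ = q
... | no _ = z≤n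

inc : Count → ℕ → ℕ → Count
inc c p n j = copies p n j + c j

dec : Count → ℕ → Count
dec c p j = c j ∸ copies p 1 j

inc-at : ∀ c p n → inc c p n p ≡ n + c p
inc-at c p n = cong (_+ c p) (copies-at p n p refl)

inc-off : ∀ c p n j → j ≢ p → inc c p n j ≡ c j
inc-off c p n j j≢p = cong (_+ c j) (copies-off p n j j≢p)

dec-at : ∀ c p → dec c p p ≡ pred (c p)
dec-at c p = cong (c p ∸_) (copies-at p 1 p refl)

dec-off : ∀ c p j → j ≢ p → dec c p j ≡ c j
dec-off c p j j≢p = cong (c j ∸_) (copies-off p 1 j j≢p)

inc-≥ : ∀ c p n j → c j ≤ inc c p n j
inc-≥ c p n j = m≤n+m (c j) (copies p n j)

≗-sym : ∀ {c c' : Count} → c ≗ c' → c' ≗ c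
≗-sym e j = sym (e j)

≗-trans : ∀ {c c' c'' : Count} → c ≗ c' → c' ≗ c'' → c ≗ c''
≗-trans e e' j = trans (e j) (e' j)

inc-cong : ∀ {c c'} p n → c ≗ c' → inc c p n ≗ inc c' p n
inc-cong p n e j = cong (copies p n j +_) (e j)

dec-cong : ∀ {c c'} p → c ≗ c' → dec c p ≗ dec c' p
dec-cong p e j = cong (_∸ copies p 1 j) (e j)

inc-comm : ∀ c p n q m → inc (inc c p n) q m ≗ inc (inc c q m) p n
inc-comm c p n q m j = x∙yz≈y∙xz +-commutativeSemigroup (copies q m j) (copies p n j) (c j)

inc-add : ∀ c p n m → inc (inc c p n) p m ≗ inc c p (m + n)
inc-add c p n m j = trans (sym (+-assoc (copies p m j) (copies p n j) (c j)))
                          (cong (_+ c j) (copies-+ p m n j))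

inc-zero : ∀ c p → inc c p 0 ≗ c
inc-zero c p j = cong (_+ c j) (copies-zero j)
  where copies-zero : ∀ j → copies p 0 j ≡ 0
        copies-zero j with j ≟ p
        ... | yes _ = refl
        ... | no _ = refl

dec-comm : ∀ c p q → dec (dec c p) q ≗ dec (dec c q) p
dec-comm c p q j = ∸-comm' (c j) (copies p 1 j) (copies q 1 j)
  where ∸-comm' : ∀ a b d → a ∸ b ∸ d ≡ a ∸ d ∸ b
        ∸-comm' a b d = trans (∸-+-assoc a b d) (trans (cong (a ∸_) (+-comm b d)) (sym (∸-+-assoc a d b)))

dec-inc : ∀ c p q n → 1 ≤ c p → dec (inc c q n) p ≗ inc (dec c p) q n
dec-inc c p q n h j = +-∸-assoc (copies q n j) (one-copy≤ (j ≟ p))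
  where one-copy≤ : Dec (j ≡ p) → copies p 1 j ≤ c j
        one-copy≤ (yes refl) = subst (_≤ c j) (sym (copies-at p 1 j refl)) h
        one-copy≤ (no j≢p) = subst (_≤ c j) (sym (copies-off p 1 j j≢p)) z≤n

dec-inc-same : ∀ c p → dec (inc c p 1) p ≗ c
dec-inc-same c p j = m+n∸m≡n (copies p 1 j) (c j)

count : List ℕ → Count
count [] j = 0
count (x ∷ xs) = inc (count xs) x 1

head-present : ∀ x xs → 1 ≤ count (x ∷ xs) x
head-present x xs = subst (1 ≤_) (sym (inc-at (count xs) x 1)) (s≤s z≤n)

count-replicate : ∀ n y → count (replicate n y) ≗ inc (λ _ → 0) y n
count-replicate zero y = ≗-sym (inc-zero (λ _ → 0) y)
count-replicate (suc n) y = ≗-trans (inc-cong y 1 (count-replicate n y)) (inc-add (λ _ → 0) y n 1)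

count-++-replicate : ∀ rest n y → count (rest ++ replicate n y) ≗ inc (count rest) y n
count-++-replicate [] n y = count-replicate n y
count-++-replicate (x ∷ r) n y =
  ≗-trans (inc-cong x 1 (count-++-replicate r n y)) (inc-comm (count r) y n x 1)

Least : Count → ℕ → Set
Least c a = 1 ≤ c a × (∀ j → j < a → c j ≡ 0)

least-or-empty : ∀ (c : Count) k → (Σ ℕ λ a → a ≤ k × Least c a) ⊎ (∀ j → j ≤ k → c j ≡ 0)
least-or-empty c zero with c 0 in e
... | zero = inj₂ (λ j q → trans (cong c (n≤0⇒n≡0 q)) e)
... | suc m = inj₁ (0 , z≤n , subst (1 ≤_) (sym e) (s≤s z≤n) , (λ j r → ⊥-elim (n≮0 r)))
least-or-empty c (suc k) with least-or-empty c k
... | inj₁ (a , q , l) = inj₁ (a , m≤n⇒m≤1+n q , l)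
... | inj₂ none-below with c (suc k) in e
... | suc m = inj₁ (suc k , ≤-refl , subst (1 ≤_) (sym e) (s≤s z≤n) , λ j r → none-below j (≤-pred r))
... | zero = inj₂ none
  where none : ∀ j → j ≤ suc k → c j ≡ 0
        none j q with m≤n⇒m<n∨m≡n q
        ... | inj₁ r = none-below j (≤-pred r)
        ... | inj₂ refl = e

least : ∀ (c : Count) k → 1 ≤ c k → Σ ℕ λ a → a ≤ k × Least c a
least c k h with least-or-empty c k
... | inj₁ r = r
... | inj₂ none = ⊥-elim (<-irrefl (sym (none k ≤-refl)) h)

maxList-attained : ∀ ws m → All (_≤ m) ws → Any (_≡ m) ws → maxList ws ≡ m
maxList-attained (w ∷ ws) m (p ∷ ps) (here refl) = m≥n⇒m⊔n≡m (bound ws ps)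
  where bound : ∀ ws → All (_≤ m) ws → maxList ws ≤ m
        bound [] [] = z≤n
        bound (w ∷ ws) (p ∷ ps) = ⊔-lub p (bound ws ps)
maxList-attained (w ∷ ws) m (p ∷ ps) (there a) = trans (cong (w ⊔_) (maxList-attained ws m ps a)) (m≤n⇒m⊔n≡n p)

suc-elapsed : ∀ T t → suc t ≤ T → suc (T ∸ suc t) ≡ T ∸ t
suc-elapsed T t q = sym (+-∸-assoc 1 q)

module Greedy (f : ℕ → ℕ) (f-mono : ∀ x y → x ≤ y → f x ≤ f y) where

  -- H k t is the end time of the longest game started at time t on {k}:
  -- playing k replaces it by N_k(t) copies of k-1, which are then played
  -- one after the other from time t+1.
  H : ℕ → ℕ → ℕ
  H zero t = suc t
  H (suc k) t = iter (N f (suc k) t) (H k) (suc t)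

  N-monotone : ∀ k {t t'} → t ≤ t' → N f k t ≤ N f k t'
  N-monotone k {t} {t'} q = *-monoʳ-≤ k (∸-monoˡ-≤ 1 (f-mono t t' q))

  H-strict : ∀ k x → x < H k x
  H-strict zero x = ≤-refl
  H-strict (suc k) x = iter-inflationary (λ y → <⇒≤ (H-strict k y)) (N f (suc k) x) (suc x)

  H-inflationary : ∀ k → Inflationary (H k)
  H-inflationary k x = <⇒≤ (H-strict k x)

  H-monotone : ∀ k → Monotone (H k)
  H-monotone zero q = s≤s q
  H-monotone (suc k) q = iter-both-monotone (H-monotone k) (H-inflationary k) (N-monotone (suc k) q) (s≤s q)

  H-step : ∀ k t → H k t ≤ H (suc k) t
  H-step k t = by-cases (f t ∸ 1) refl
    where
    by-cases : ∀ m → f t ∸ 1 ≡ m → H k t ≤ H (suc k) t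
    by-cases zero e = ≤-reflexive (trans (H-trivial k) (sym (H-trivial (suc k))))
      where H-trivial : ∀ j → H j t ≡ suc t
            H-trivial zero = refl
            H-trivial (suc j) rewrite e | *-zeroʳ j = refl
    by-cases (suc m) e rewrite e =
      ≤-trans (H-monotone k (n≤1+n t)) (H-monotone k (iter-inflationary (H-inflationary k) (m + k * suc m) (suc t)))

  -- The greedy strategy on a multiset with multiplicities c, restricted to
  -- the elements ≤ K: play the copies of 0, then those of 1, … .  It ends
  -- at time  H_K^{c K} (… (H_0^{c 0} t)).
  greedy : Count → ℕ → ℕ → ℕ
  greedy-below : Count → ℕ → ℕ → ℕ
  greedy c K t = iter (c K) (H K) (greedy-below c K t)
  greedy-below c zero t = t
  greedy-below c (suc j) t = greedy c j t

  greedy-inflationary : ∀ c K t → t ≤ greedy c K t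
  greedy-below-inflationary : ∀ c K t → t ≤ greedy-below c K t
  greedy-inflationary c K t =
    ≤-trans (greedy-below-inflationary c K t) (iter-inflationary (H-inflationary K) (c K) _)
  greedy-below-inflationary c zero t = ≤-refl
  greedy-below-inflationary c (suc K) t = greedy-inflationary c K t

  greedy-cong : ∀ {c c'} K t → (∀ j → j ≤ K → c j ≡ c' j) → greedy c K t ≡ greedy c' K t
  greedy-cong zero t e rewrite e 0 z≤n = refl
  greedy-cong (suc K) t e rewrite e (suc K) ≤-refl | greedy-cong K t (λ j q → e j (m≤n⇒m≤1+n q)) = refl

  greedy-≗ : ∀ {c c'} K t → c ≗ c' → greedy c K t ≡ greedy c' K t
  greedy-≗ K t e = greedy-cong K t (λ j _ → e j)

  greedy-below-cong : ∀ {c c'} i t → (∀ j → j < i → c j ≡ c' j) → greedy-below c i t ≡ greedy-below c' i t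
  greedy-below-cong zero t e = refl
  greedy-below-cong (suc i) t e = greedy-cong i t (λ j q → e j (s≤s q))

  greedy-monotone : ∀ {c c'} K → (∀ j → c j ≤ c' j) → ∀ {t t'} → t ≤ t' → greedy c K t ≤ greedy c' K t'
  greedy-monotone zero le q = iter-both-monotone (H-monotone 0) (H-inflationary 0) (le 0) q
  greedy-monotone (suc K) le q =
    iter-both-monotone (H-monotone (suc K)) (H-inflationary (suc K)) (le (suc K)) (greedy-monotone K le q)

  greedy-empty : ∀ c i t → (∀ j → j ≤ i → c j ≡ 0) → greedy c i t ≡ t
  greedy-empty c zero t e rewrite e 0 z≤n = refl
  greedy-empty c (suc i) t e rewrite e (suc i) ≤-refl = greedy-empty c i t (λ j q → e j (m≤n⇒m≤1+n q))

  greedy-below-empty : ∀ c i t → (∀ j → j < i → c j ≡ 0) → greedy-below c i t ≡ t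
  greedy-below-empty c zero t e = refl
  greedy-below-empty c (suc i) t e = greedy-empty c i t (λ j q → e j (s≤s q))

  greedy-above : ∀ {c c' i K t t'} → i ≤ K → greedy c i t ≤ greedy c' i t' →
    (∀ j → i < j → c j ≡ c' j) → greedy c K t ≤ greedy c' K t'
  greedy-above {c} {c'} {i} {t = t} {t'} q le e = go (≤⇒≤′ q)
    where
    go : ∀ {K} → i ≤′ K → greedy c K t ≤ greedy c' K t'
    go ≤′-refl = le
    go {suc K} (≤′-step q) rewrite e (suc K) (s≤s (≤′⇒≤ q)) = iter-monotone (H-monotone (suc K)) (c' (suc K)) (go q)

  greedy-above-≡ : ∀ {c c' i K t t'} → i ≤ K → greedy c i t ≡ greedy c' i t' →
    (∀ j → i < j → c j ≡ c' j) → greedy c K t ≡ greedy c' K t'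
  greedy-above-≡ q e e₂ =
    ≤-antisym (greedy-above q (≤-reflexive e) e₂) (greedy-above q (≤-reflexive (sym e)) (λ j r → sym (e₂ j r)))

  greedy-nonempty : ∀ c K a t → a ≤ K → 1 ≤ c a → t < greedy c K t
  greedy-nonempty c K a t q h = ≤-trans (at-level (c a) refl) (grow (≤⇒≤′ q))
    where
    at-level : ∀ m → c a ≡ m → t < greedy c a t
    at-level (suc m) e rewrite e =
      ≤-trans (s≤s (≤-trans (greedy-below-inflationary c a t) (iter-inflationary (H-inflationary a) m _)))
              (H-strict a _)
    at-level zero e = ⊥-elim (<-irrefl (sym e) h)
    grow : ∀ {K} → a ≤′ K → greedy c a t ≤ greedy c K t
    grow ≤′-refl = ≤-refl
    grow {suc K} (≤′-step q) = ≤-trans (grow q) (iter-inflationary (H-inflationary (suc K)) (c (suc K)) _)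

  -- Exchange: moving copies to a higher level (at most K) does not shorten
  -- the greedy game.  First for one copy moved up by one level.
  raise-one-level : ∀ Z b t → greedy (inc Z b 1) (suc b) t ≤ greedy (inc Z (suc b) 1) (suc b) t
  raise-one-level Z b t
    rewrite inc-off Z b 1 (suc b) (1+n≢n {b}) | inc-at Z (suc b) 1
          | inc-at Z b 1 | inc-off Z (suc b) 1 b (λ e → 1+n≢n {b} (sym e))
          | greedy-below-cong {inc Z b 1} {Z} b t (λ j q → inc-off Z b 1 j (<⇒≢ q))
          | greedy-below-cong {inc Z (suc b) 1} {Z} b t (λ j q → inc-off Z (suc b) 1 j (<⇒≢ (m≤n⇒m≤1+n q)))
    = ≤-trans (iter-monotone (H-monotone (suc b)) (Z (suc b)) (H-step b _))
              (≤-reflexive (iter-comm (Z (suc b)) (H (suc b)) _))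

  raise-one : ∀ Z p q K t → p ≤ q → q ≤ K → greedy (inc Z p 1) K t ≤ greedy (inc Z q 1) K t
  raise-one Z p q K t s r = go (≤⇒≤′ s) r
    where
    go : ∀ {q} → p ≤′ q → q ≤ K → greedy (inc Z p 1) K t ≤ greedy (inc Z q 1) K t
    go ≤′-refl r = ≤-refl
    go {suc q} (≤′-step s) r = ≤-trans (go s (≤-trans (n≤1+n q) r)) (greedy-above r (raise-one-level Z q t) agree)
      where
      agree : ∀ j → suc q < j → inc Z q 1 j ≡ inc Z (suc q) 1 j
      agree j r' = trans (inc-off Z q 1 j (λ e → <⇒≢ (≤-trans (n≤1+n _) r') (sym e)))
                         (sym (inc-off Z (suc q) 1 j (λ e → <⇒≢ r' (sym e))))

  raise-copies : ∀ d Y p q K t → p ≤ q → q ≤ K → greedy (inc Y p d) K t ≤ greedy (inc Y q d) K t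
  raise-copies zero Y p q K t s r = ≤-reflexive (trans (greedy-≗ K t (inc-zero Y p)) (sym (greedy-≗ K t (inc-zero Y q))))
  raise-copies (suc d) Y p q K t s r =
    begin
      greedy (inc Y p (suc d)) K t
    ≡⟨ greedy-≗ K t (≗-sym (inc-add Y p d 1)) ⟩
      greedy (inc (inc Y p d) p 1) K t
    ≤⟨ raise-one (inc Y p d) p q K t s r ⟩
      greedy (inc (inc Y p d) q 1) K t
    ≡⟨ greedy-≗ K t (inc-comm Y p d q 1) ⟩
      greedy (inc (inc Y q 1) p d) K t
    ≤⟨ raise-copies d (inc Y q 1) p q K t s r ⟩
      greedy (inc (inc Y q 1) q d) K t
    ≡⟨ greedy-≗ K t (≗-trans (inc-add Y q 1 d) (λ j → cong (λ z → inc Y q z j) (+-comm d 1))) ⟩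
      greedy (inc Y q (suc d)) K t
    ∎
    where open ≤-Reasoning

  raise : ∀ Y p q d e K t → p ≤ q → q ≤ K → d ≤ e → greedy (inc Y p d) K t ≤ greedy (inc Y q e) K t
  raise Y p q d e K t s r le =
    ≤-trans (raise-copies d Y p q K t s r) (greedy-monotone K (λ j → +-monoˡ-≤ (Y j) (copies-mono q le j)) ≤-refl)

  afterMove : Count → ℕ → ℕ → Count
  afterMove c k t = inc (dec c k) (k ∸ 1) (N f k t)

  afterMove-above : ∀ c a t j → a < j → afterMove c a t j ≡ c j
  afterMove-above c a t j r =
    trans (inc-off (dec c a) (a ∸ 1) (N f a t) j (λ e → <⇒≢ (≤-trans (s≤s (m∸n≤m a 1)) r) (sym e)))
          (dec-off c a j (λ e → <⇒≢ r (sym e)))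

  greedy-move-least-level : ∀ c a t → Least c a → greedy c a t ≡ greedy (afterMove c a t) a (suc t)
  greedy-move-least-level c zero t (h₁ , _) rewrite inc-at (dec c 0) 0 0 | dec-at c 0 with c 0 | h₁
  ... | suc m | _ = sym (iter-comm m suc t)
  greedy-move-least-level c (suc a) t (h₁ , h₀)
    rewrite greedy-empty c a t (λ j q → h₀ j (s≤s q))
          | inc-off (dec c (suc a)) a (N f (suc a) t) (suc a) (1+n≢n {a})
          | dec-at c (suc a)
          | inc-at (dec c (suc a)) a (N f (suc a) t)
          | dec-off c (suc a) a (λ e → 1+n≢n {a} (sym e))
          | h₀ a ≤-refl
          | +-identityʳ (N f (suc a) t)
          | greedy-below-empty (afterMove c (suc a) t) a (suc t)
              (λ j q → trans (inc-off (dec c (suc a)) a (N f (suc a) t) j (<⇒≢ q))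
                             (trans (dec-off c (suc a) j (<⇒≢ (m≤n⇒m≤1+n q))) (h₀ j (m≤n⇒m≤1+n q))))
    with c (suc a) | h₁
  ... | suc m | _ = sym (iter-comm m (H (suc a)) t)

  greedy-move-least : ∀ c a K t → a ≤ K → Least c a → greedy c K t ≡ greedy (afterMove c a t) K (suc t)
  greedy-move-least c a K t q l =
    greedy-above-≡ q (greedy-move-least-level c a t l) (λ j r → sym (afterMove-above c a t j r))

  afterMove-keeps : ∀ c a t k → k ≢ a → 1 ≤ c k → 1 ≤ afterMove c a t k
  afterMove-keeps c a t k k≢a ck =
    ≤-trans (subst (1 ≤_) (sym (dec-off c a k k≢a)) ck) (inc-≥ (dec c a) (a ∸ 1) (N f a t) k)

  least-after-larger-move : ∀ c a k t → a < k → Least c a → Least (afterMove c k t) a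
  least-after-larger-move c a k t a<k (ca , c0) =
    afterMove-keeps c k t a (<⇒≢ a<k) ca , below
    where
    a≤k∸1 : a ≤ k ∸ 1
    a≤k∸1 = suc[m]≤n⇒m≤pred[n] a<k
    below : ∀ j → j < a → afterMove c k t j ≡ 0
    below j r = trans (inc-off (dec c k) (k ∸ 1) (N f k t) j (<⇒≢ (≤-trans r a≤k∸1)))
                      (trans (dec-off c k j (<⇒≢ (<-trans r a<k))) (c0 j r))

  ΔN : ℕ → ℕ → ℕ
  ΔN a t = N f a (suc t) ∸ N f a t

  ΔN-monotone : ∀ a k t → a ≤ k → ΔN a t ≤ ΔN k t
  ΔN-monotone a k t q = begin
      a * (f (suc t) ∸ 1) ∸ a * (f t ∸ 1)
    ≡⟨ sym (*-distribˡ-∸ a _ _) ⟩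
      a * ((f (suc t) ∸ 1) ∸ (f t ∸ 1))
    ≤⟨ *-monoˡ-≤ _ q ⟩
      k * ((f (suc t) ∸ 1) ∸ (f t ∸ 1))
    ≡⟨ *-distribˡ-∸ k _ _ ⟩
      k * (f (suc t) ∸ 1) ∸ k * (f t ∸ 1)
    ∎
    where open ≤-Reasoning

  N-split : ∀ a t → N f a (suc t) ≡ ΔN a t + N f a t
  N-split a t = sym (m∸n+n≡m (N-monotone a (n≤1+n t)))

  -- Two moves at times t and t+1 in either order lead to the same multiset,
  -- up to ΔN extra copies created by the later move.
  twoMoves : Count → ℕ → ℕ → ℕ → Count
  twoMoves c k a t = inc (inc (dec (dec c k) a) (k ∸ 1) (N f k t)) (a ∸ 1) (N f a t)

  move-then-move : ∀ c k a t → a ≢ k → 1 ≤ c a →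
    afterMove (afterMove c k t) a (suc t) ≗ inc (twoMoves c k a t) (a ∸ 1) (ΔN a t)
  move-then-move c k a t a≢k ca =
    ≗-trans (inc-cong (a ∸ 1) (N f a (suc t)) (dec-inc (dec c k) a (k ∸ 1) (N f k t) dca))
    (≗-trans (λ j → cong (λ n → inc X (a ∸ 1) n j) (N-split a t))
             (≗-sym (inc-add X (a ∸ 1) (N f a t) (ΔN a t))))
    where
    X : Count
    X = inc (dec (dec c k) a) (k ∸ 1) (N f k t)
    dca : 1 ≤ dec c k a
    dca = subst (1 ≤_) (sym (dec-off c k a a≢k)) ca

  twoMoves-sym : ∀ c k a t → twoMoves c k a t ≗ twoMoves c a k t
  twoMoves-sym c k a t =
    ≗-trans (inc-comm (dec (dec c k) a) (k ∸ 1) (N f k t) (a ∸ 1) (N f a t))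
            (inc-cong (k ∸ 1) (N f k t) (inc-cong (a ∸ 1) (N f a t) (dec-comm c k a)))

  -- If k ≠ a, playing k and then a is compared
  -- with playing a and then k: the two differ only by ΔN a t copies of a-1
  -- versus ΔN k t ≥ ΔN a t copies of k-1, and the rest follows by induction
  -- on the length of the greedy game.
  greedy-optimal : ∀ K c t k → k ≤ K → 1 ≤ c k → greedy (afterMove c k t) K (suc t) ≤ greedy c K t
  greedy-optimal K c t = go (greedy c K t ∸ t) c t (sym (m+[n∸m]≡n (greedy-inflationary c K t)))
    where
    go : ∀ n c t → greedy c K t ≡ t + n → ∀ k → k ≤ K → 1 ≤ c k →
         greedy (afterMove c k t) K (suc t) ≤ greedy c K t
    go n c t e k kK ck with least c k ck
    ... | a , ak , l@(ca , _) with a ≟ k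
    ... | yes refl = ≤-reflexive (sym (greedy-move-least c a K t kK l))
    ... | no a≢k with n
    ... | zero = ⊥-elim (<-irrefl (sym (+-identityʳ t))
                          (≤-trans (greedy-nonempty c K a t (≤-trans ak kK) ca) (≤-reflexive e)))
    ... | suc n =
      begin
        greedy (afterMove c k t) K (suc t)
      ≡⟨ greedy-move-least (afterMove c k t) a K (suc t) aK (least-after-larger-move c a k t a<k l) ⟩
        greedy (afterMove (afterMove c k t) a (suc t)) K (suc (suc t))
      ≡⟨ greedy-≗ K _ (move-then-move c k a t a≢k ca) ⟩
        greedy (inc (twoMoves c k a t) (a ∸ 1) (ΔN a t)) K (suc (suc t))
      ≤⟨ raise (twoMoves c k a t) (a ∸ 1) (k ∸ 1) (ΔN a t) (ΔN k t) K _
               (∸-monoˡ-≤ 1 ak) (≤-trans (m∸n≤m k 1) kK) (ΔN-monotone a k t ak) ⟩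
        greedy (inc (twoMoves c k a t) (k ∸ 1) (ΔN k t)) K (suc (suc t))
      ≡⟨ greedy-≗ K _ (≗-sym (≗-trans (move-then-move c a k t (λ e → a≢k (sym e)) ck)
                                      (inc-cong (k ∸ 1) (ΔN k t) (twoMoves-sym c a k t)))) ⟩
        greedy (afterMove (afterMove c a t) k (suc t)) K (suc (suc t))
      ≤⟨ go n (afterMove c a t) (suc t) (trans (sym first) (trans e (+-suc t n))) k kK
            (afterMove-keeps c a t k (λ e → a≢k (sym e)) ck) ⟩
        greedy (afterMove c a t) K (suc t)
      ≡⟨ sym first ⟩
        greedy c K t
      ∎
      where
      open ≤-Reasoning
      a<k : a < k
      a<k = ≤∧≢⇒< ak a≢k
      aK : a ≤ K
      aK = ≤-trans ak kK
      first : greedy c K t ≡ greedy (afterMove c a t) K (suc t)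
      first = greedy-move-least c a K t aK l

  Choice : ℕ → List ℕ → ℕ × List ℕ → Set
  Choice K τ p = count τ ≗ inc (count (proj₂ p)) (proj₁ p) 1 × proj₁ p ≤ K × All (_≤ K) (proj₂ p)

  picks-choices : ∀ K τ → All (_≤ K) τ → All (Choice K τ) (picks τ)
  picks-choices K [] [] = []
  picks-choices K (x ∷ xs) (xK ∷ xsK) =
    ((λ j → refl) , xK , xsK) ∷ All-map⁺ (extend (picks xs) (picks-choices K xs xsK))
    where
    extend : ∀ ps → All (Choice K xs) ps →
             All (λ p → Choice K (x ∷ xs) (proj₁ p , x ∷ proj₂ p)) ps
    extend [] [] = []
    extend ((k , r) ∷ ps) ((e , kK , rK) ∷ cs) =
      (≗-trans (inc-cong x 1 e) (inc-comm (count r) k 1 x 1) , kK , xK ∷ rK) ∷ extend ps cs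

  picks-complete : ∀ τ a → 1 ≤ count τ a → Any (λ p → proj₁ p ≡ a) (picks τ)
  picks-complete (x ∷ xs) a h = by-cases (a ≟ x)
    where
    by-cases : Dec (a ≡ x) → Any (λ p → proj₁ p ≡ a) (picks (x ∷ xs))
    by-cases (yes e) = here (sym e)
    by-cases (no a≢x) = there (Any-map⁺ (picks-complete xs a (subst (1 ≤_) (inc-off (count xs) x 1 a a≢x) h)))

  choice-present : ∀ {K τ p} → Choice K τ p → 1 ≤ count τ (proj₁ p)
  choice-present {p = k , r} (e , _ , _) = subst (1 ≤_) (sym (trans (e k) (inc-at (count r) k 1))) (s≤s z≤n)

  count-stepType : ∀ τ k r t → count τ ≗ inc (count r) k 1 → count (stepType f k r t) ≗ afterMove (count τ) k t
  count-stepType τ k r t e = ≗-trans (count-++-replicate r (N f k t) (k ∸ 1))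
    (inc-cong (k ∸ 1) (N f k t) (≗-sym (≗-trans (dec-cong k e) (dec-inc-same (count r) k))))

  stepType-bounded : ∀ K k r t → k ≤ K → All (_≤ K) r → All (_≤ K) (stepType f k r t)
  stepType-bounded K k r t kK rK = All-++⁺ rK (All-replicate⁺ (N f k t) (≤-trans (m∸n≤m k 1) kK))

  afterChoice : ℕ → ℕ → ℕ × List ℕ → ℕ
  afterChoice K t p = greedy (count (stepType f (proj₁ p) (proj₂ p) t)) K (suc t)

  afterChoice-≤ : ∀ K τ t p → Choice K τ p → afterChoice K t p ≤ greedy (count τ) K t
  afterChoice-≤ K τ t p@(k , r) ch@(e , kK , _) =
    ≤-trans (≤-reflexive (greedy-≗ K (suc t) (count-stepType τ k r t e)))
            (greedy-optimal K (count τ) t k kK (choice-present {K} {τ} {p} ch))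

  afterChoice-least : ∀ K τ t p → Choice K τ p → Least (count τ) (proj₁ p) →
    afterChoice K t p ≡ greedy (count τ) K t
  afterChoice-least K τ t p@(k , r) (e , kK , _) l =
    trans (greedy-≗ K (suc t) (count-stepType τ k r t e)) (sym (greedy-move-least (count τ) k K t kK l))

  subgameLength : ℕ → ℕ → ℕ × List ℕ → ℕ
  subgameLength K t p = afterChoice K t p ∸ suc t

  best-choice : ∀ K τ t (ps : List (ℕ × List ℕ)) → All (Choice K τ) ps →
    ∀ a → Least (count τ) a → Any (λ p → proj₁ p ≡ a) ps →
    maxList (map suc (map (subgameLength K t) ps)) ≡ greedy (count τ) K t ∸ t
  best-choice K τ t ps chs a l hit = maxList-attained _ _ (bounded ps chs) (attained ps chs hit)
    where
    elapsed : ∀ p → suc (subgameLength K t p) ≡ afterChoice K t p ∸ t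
    elapsed p = suc-elapsed _ t (greedy-inflationary (count (stepType f (proj₁ p) (proj₂ p) t)) K (suc t))
    bounded : ∀ ps → All (Choice K τ) ps → All (_≤ greedy (count τ) K t ∸ t) (map suc (map (subgameLength K t) ps))
    bounded [] [] = []
    bounded (p ∷ ps) (ch ∷ chs) =
      subst (_≤ greedy (count τ) K t ∸ t) (sym (elapsed p)) (∸-monoˡ-≤ t (afterChoice-≤ K τ t p ch)) ∷ bounded ps chs
    attained : ∀ ps → All (Choice K τ) ps → Any (λ p → proj₁ p ≡ a) ps →
               Any (_≡ greedy (count τ) K t ∸ t) (map suc (map (subgameLength K t) ps))
    attained (p ∷ ps) (ch ∷ _) (here refl) = here (trans (elapsed p) (cong (_∸ t) (afterChoice-least K τ t p ch l)))
    attained (p ∷ ps) (_ ∷ chs) (there h) = there (attained ps chs h)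

  M-greedy : ∀ K τ t → All (_≤ K) τ → MG f τ t (greedy (count τ) K t ∸ t)
  M-greedy K τ t τK = go (greedy (count τ) K t ∸ t) τ t τK (≤-reflexive (sym (m+[n∸m]≡n (greedy-inflationary (count τ) K t))))
    where
    go : ∀ n τ t → All (_≤ K) τ → greedy (count τ) K t ≤ t + n → MG f τ t (greedy (count τ) K t ∸ t)
    go n [] t _ _ = subst (MG f [] t) (sym (trans (cong (_∸ t) (greedy-empty (count []) K t (λ _ _ → refl))) (n∸n≡0 t)))
                          (M-def [] [])
    go zero (x ∷ xs) t (xK ∷ _) b =
      ⊥-elim (<-irrefl (sym (+-identityʳ t)) (≤-trans (greedy-nonempty (count (x ∷ xs)) K x t xK (head-present x xs)) b))
    go (suc n) τ@(x ∷ xs) t τK@(xK ∷ _) b with least (count τ) x (head-present x xs)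
    ... | a , _ , l = subst (MG f τ t) (best-choice K τ t (picks τ) chs a l (picks-complete τ a (proj₁ l)))
                            (M-def _ (subgames (picks τ) chs))
      where
      chs : All (Choice K τ) (picks τ)
      chs = picks-choices K τ τK
      subgames : ∀ ps → All (Choice K τ) ps →
        Pointwise (λ p v → MG f (stepType f (proj₁ p) (proj₂ p) t) (suc t) v) ps (map (subgameLength K t) ps)
      subgames [] [] = []
      subgames (p@(k , r) ∷ ps) (ch@(_ , kK , rK) ∷ chs) =
        go n (stepType f k r t) (suc t) (stepType-bounded K k r t kK rK)
           (≤-trans (afterChoice-≤ K τ t p ch) (≤-trans b (≤-reflexive (+-suc t n))))
        ∷ subgames ps chs

  greedy-replicate : ∀ r k t → greedy (count (replicate r k)) k t ≡ iter r (H k) t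
  greedy-replicate r k t =
    trans (greedy-≗ k t (count-replicate r k))
    (trans (cong (λ n → iter n (H k) (greedy-below (inc (λ _ → 0) k r) k t)) (trans (inc-at (λ _ → 0) k r) (+-identityʳ r)))
           (cong (iter r (H k)) (greedy-below-empty (inc (λ _ → 0) k r) k t (λ j q → inc-off (λ _ → 0) k r j (<⇒≢ q)))))

  M-replicate : ∀ r k t → MG f (replicate r k) t (iter r (H k) t ∸ t)
  M-replicate r k t = subst (λ z → MG f (replicate r k) t (z ∸ t)) (greedy-replicate r k t)
    (M-greedy k (replicate r k) t (All-replicate⁺ r ≤-refl))

inF-mono : ∀ {α α' n g} → α ≤o α' → InF α n g → InF α' n g
inF-mono le F-const0 = F-const0
inF-mono le F-add = F-add
inF-mono le (F-proj i) = F-proj i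
inF-mono {α} {α'} le (F-fast {β} cb q h hf) = F-fast cb (≤o-trans β α α' q le) h hf
inF-mono le (F-subst dg dhs) = F-subst (inF-mono le dg) (λ i → inF-mono le (dhs i))
inF-mono le (F-lrec h dg dk db e0 es hb) = F-lrec h (inF-mono le dg) (inF-mono le dk) (inF-mono le db) e0 es hb
inF-mono le (F-ext d e) = F-ext (inF-mono le d) e

lookup-zero≡head : ∀ (v : Vec ℕ 1) → lookup v fz ≡ head v
lookup-zero≡head (x ∷ᵥ []) = refl

module Closure {α : Ord} where

  inF-comp₁ : ∀ {n} {g : ℕ → ℕ} {h : Vec ℕ n → ℕ} → InF α 1 (λ v → g (head v)) → InF α n h →
    InF α n (λ v → g (h v))
  inF-comp₁ {h = h} dg dh = F-ext (F-subst {hs = λ _ → h} dg (λ _ → dh)) (λ v → refl)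

  inF-comp₂ : ∀ {n} {g : ℕ → ℕ → ℕ} {h₁ h₂ : Vec ℕ n → ℕ} →
    InF α 2 (λ v → g (lookup v fz) (lookup v (fs fz))) → InF α n h₁ → InF α n h₂ →
    InF α n (λ v → g (h₁ v) (h₂ v))
  inF-comp₂ {n} {g} {h₁} {h₂} dg d₁ d₂ = F-ext (F-subst {hs = hs} dg dhs) (λ v → refl)
    where
    hs : Fin 2 → Vec ℕ n → ℕ
    hs fz = h₁
    hs (fs fz) = h₂
    dhs : ∀ i → InF α n (hs i)
    dhs fz = d₁
    dhs (fs fz) = d₂

  inF-id : InF α 1 (λ v → head v)
  inF-id = F-ext (F-proj fz) lookup-zero≡head

  inF-suc : InF α 1 (λ v → suc (head v))
  inF-suc = F-fast {β = 𝟎} cnf𝟎 (𝟎≤o α) suc (λ x → F-zero refl)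

  inF-const : ∀ {n} c → InF α n (λ _ → c)
  inF-const zero = F-const0
  inF-const (suc c) = inF-comp₁ {g = suc} inF-suc (inF-const c)

  inF-+ : ∀ {n} {h₁ h₂ : Vec ℕ n → ℕ} → InF α n h₁ → InF α n h₂ → InF α n (λ v → h₁ v + h₂ v)
  inF-+ d₁ d₂ = inF-comp₂ {g = _+_} F-add d₁ d₂

  inF-scale : ∀ {n} {h : Vec ℕ n → ℕ} c → InF α n h → InF α n (λ v → c * h v)
  inF-scale zero d = F-const0
  inF-scale (suc c) d = inF-+ d (inF-scale c d)

  inF-pred : InF α 1 (λ v → pred (head v))
  inF-pred = F-lrec (λ v → pred (head v)) F-const0 (F-proj fz) (F-ext (F-proj fz) lookup-zero≡head)
                    (λ v → refl) (λ y v → refl) (λ { (x ∷ᵥ []) → pred[n]≤n })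

  inF-∸ : ∀ {n} {h₁ h₂ : Vec ℕ n → ℕ} → InF α n h₁ → InF α n h₂ → InF α n (λ v → h₁ v ∸ h₂ v)
  inF-∸ d₁ d₂ = inF-comp₂ {g = λ a b → b ∸ a} monus d₂ d₁
    where
    -- (y , x) ↦ x ∸ y, by recursion on y
    monus : InF α 2 (λ v → lookup v (fs fz) ∸ lookup v fz)
    monus = F-lrec (λ v → lookup v (fs fz) ∸ lookup v fz) (F-proj fz)
                   (inF-comp₁ {g = pred} inF-pred (F-proj (fs fz))) (F-proj (fs fz))
                   (λ { (x ∷ᵥ []) → refl })
                   (λ { y (x ∷ᵥ []) → sym (pred[m∸n]≡m∸[1+n] x y) })
                   (λ { (y ∷ᵥ x ∷ᵥ []) → m∸n≤m x y })

  inF-iter-bounded : ∀ {g : ℕ → ℕ} {b : Vec ℕ 2 → ℕ} → InF α 1 (λ v → g (head v)) → InF α 2 b →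
    (∀ n x → iter n g x ≤ b (n ∷ᵥ x ∷ᵥ [])) → InF α 2 (λ v → iter (lookup v fz) g (lookup v (fs fz)))
  inF-iter-bounded {g} dg db bound =
    F-lrec (λ v → iter (lookup v fz) g (lookup v (fs fz))) (F-proj fz) (inF-comp₁ {g = g} dg (F-proj (fs fz))) db
           (λ v → refl) (λ y v → refl) (λ { (n ∷ᵥ x ∷ᵥ []) → bound n x })

  inF-iter : ∀ {g : ℕ → ℕ} r → InF α 1 (λ v → g (head v)) → InF α 1 (λ v → iter r g (head v))
  inF-iter zero dg = inF-id
  inF-iter {g} (suc r) dg = inF-comp₁ {g = g} dg (inF-iter r dg)

open Closure

Fast : Ord → ℕ → ℕ
Fast α x = proj₁ (FG-total α x)

Fast-graph : ∀ α x → FG α x (Fast α x)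
Fast-graph α x = proj₂ (FG-total α x)

Fast-monotone : ∀ α → Monotone (Fast α)
Fast-monotone α q = FG-monotone (Fast-graph α _) (Fast-graph α _) q

Fast-strict : ∀ α x → x < Fast α x
Fast-strict α x = FG-inflationary (Fast-graph α x)

Fast-inflationary : ∀ α → Inflationary (Fast α)
Fast-inflationary α x = <⇒≤ (Fast-strict α x)

Fast-suc-o : ∀ α x → Fast (suc-o α) x ≡ iter (suc x) (Fast α) x
Fast-suc-o α x = FG-functional (Fast-graph (suc-o α) x) (F-succ (view-suc-o α) (iterates (suc x) x))
  where
  iterates : ∀ n x → Iter α n x (iter n (Fast α) x)
  iterates zero x = it-zero
  iterates (suc n) x = it-suc (Fast-graph α x) (subst (Iter α n (Fast α x)) (iter-comm n (Fast α) x) (iterates n (Fast α x)))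

Fast-suc-o-≥ : ∀ α x → Fast α x ≤ Fast (suc-o α) x
Fast-suc-o-≥ α x =
  ≤-trans (iter-count-monotone (Fast-inflationary α) {1} {suc x} x (s≤s z≤n)) (≤-reflexive (sym (Fast-suc-o α x)))

Fast-+ℕ-≥ : ∀ γ j x → Fast γ x ≤ Fast (γ +ℕ j) x
Fast-+ℕ-≥ γ zero x = ≤-refl
Fast-+ℕ-≥ γ (suc j) x = ≤-trans (Fast-+ℕ-≥ γ j x) (Fast-suc-o-≥ (γ +ℕ j) x)

Fast-suc-o-doubles : ∀ α z → suc (z + z) ≤ Fast (suc-o α) z
Fast-suc-o-doubles α z = ≤-trans (iter-strict (Fast-strict α) (suc z) z) (≤-reflexive (sym (Fast-suc-o α z)))

Fast-suc-o-linear : ∀ α m Y → m * Y + suc Y ≤ iter (suc m) (Fast (suc-o α)) Y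
Fast-suc-o-linear α zero Y = ≤-trans (s≤s (m≤m+n Y Y)) (Fast-suc-o-doubles α Y)
Fast-suc-o-linear α (suc m) Y = ≤-trans (≤-reflexive (+-assoc Y (m * Y) (suc Y)))
  (≤-trans (+-mono-≤ (iter-inflationary (Fast-inflationary (suc-o α)) (suc m) Y) (Fast-suc-o-linear α m Y))
           (≤-trans (n≤1+n _) (Fast-suc-o-doubles α _)))

-- For γ ≥ 1, F_γ applied twice doubles, since F_1(y) = 2y + 1.
Fast-twice-doubles : ∀ γ → CNF γ → γ ≢ 𝟎 → ∀ y → y + y ≤ Fast γ (Fast γ y)
Fast-twice-doubles γ cγ γ≢𝟎 y =
  ≤-trans (n≤1+n (y + y))
    (≤-trans (FG-compare one γ y (suc y + y) (Fast γ (y + 1)) (cnfω cnf𝟎 cnf𝟎 tt) cγ (one≤o γ γ≢𝟎) F₁ (Fast-graph γ (y + 1)))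
             (Fast-monotone γ (≤-trans (≤-reflexive (+-comm y 1)) (Fast-strict γ y))))
  where
  one : Ord
  one = ω^ 𝟎 + 𝟎
  one≤o : ∀ γ → γ ≢ 𝟎 → one ≤o γ
  one≤o 𝟎 γ≢𝟎 = ⊥-elim (γ≢𝟎 refl)
  one≤o (ω^ a + b) _ with cmp 𝟎 a in e
  ... | lt = λ ()
  ... | eq = 𝟎≤o b
  ... | gt = ⊥-elim (𝟎≤o a e)
  iterate-suc : ∀ n x → Iter 𝟎 n x (n + x)
  iterate-suc zero x = it-zero
  iterate-suc (suc n) x = it-suc (F-zero refl) (subst (Iter 𝟎 n (suc x)) (+-suc n x) (iterate-suc n (suc x)))
  F₁ : FG one y (suc y + y)
  F₁ = F-succ refl (iterate-suc (suc y) y)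

maxV : ∀ {n} → Vec ℕ n → ℕ
maxV [] = 0
maxV (x ∷ᵥ v) = x ⊔ maxV v

lookup≤maxV : ∀ {n} (v : Vec ℕ n) i → lookup v i ≤ maxV v
lookup≤maxV (x ∷ᵥ v) fz = m≤m⊔n x (maxV v)
lookup≤maxV (x ∷ᵥ v) (fs i) = ≤-trans (lookup≤maxV v i) (m≤n⊔m x (maxV v))

maxV-tabulate≤ : ∀ {n} (F : Fin n → ℕ) B → (∀ i → F i ≤ B) → maxV (tabulate F) ≤ B
maxV-tabulate≤ {zero} F B le = z≤n
maxV-tabulate≤ {suc n} F B le = ⊔-lub (le fz) (maxV-tabulate≤ (λ i → F (fs i)) B (λ i → le (fs i)))

sumFin : ∀ m → (Fin m → ℕ) → ℕ
sumFin zero F = 0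
sumFin (suc m) F = F fz + sumFin m (λ i → F (fs i))

sumFin-≥ : ∀ m F i → F i ≤ sumFin m F
sumFin-≥ (suc m) F fz = m≤m+n (F fz) _
sumFin-≥ (suc m) F (fs i) = ≤-trans (sumFin-≥ m (λ i → F (fs i)) i) (m≤n+m _ (F fz))

module Majorise (γ : Ord) (cγ : CNF γ) (twice-doubles : ∀ y → y + y ≤ Fast γ (Fast γ y)) where

  Φ : ℕ → ℕ
  Φ = Fast γ

  majorise : ∀ {n g} → InF γ n g → Σ ℕ λ c → ∀ v → g v ≤ iter c Φ (maxV v)
  majorise F-const0 = 0 , λ v → z≤n
  majorise F-add = 2 , λ v →
    ≤-trans (+-mono-≤ (lookup≤maxV v fz) (lookup≤maxV v (fs fz))) (twice-doubles _)
  majorise (F-proj i) = 0 , λ v → lookup≤maxV v i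
  majorise (F-fast {β} cβ le h hf) = suc (norm β) , λ { (x ∷ᵥ []) → bound x }
    where
    -- F_β(x) ≤ F_γ(x + norm β) ≤ F_γ(F_γ^{norm β}(x))
    bound : ∀ x → h x ≤ Φ (iter (norm β) Φ (x ⊔ 0))
    bound x = ≤-trans (FG-monotone (hf x) (hf (x ⊔ 0)) (m≤m⊔n x 0))
      (≤-trans (FG-compare β γ (x ⊔ 0) _ _ cβ cγ le (hf (x ⊔ 0)) (Fast-graph γ _))
               (Fast-monotone γ (≤-trans (≤-reflexive (+-comm (x ⊔ 0) (norm β))) (iter-strict (Fast-strict γ) (norm β) (x ⊔ 0)))))
  majorise (F-subst {m} {g = g} {hs} dg dhs) = cg + C , bound
    where
    cg : ℕ
    cg = proj₁ (majorise dg)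
    cs : Fin m → ℕ
    cs i = proj₁ (majorise (dhs i))
    C : ℕ
    C = sumFin m cs
    bound : ∀ v → g (tabulate (λ i → hs i v)) ≤ iter (cg + C) Φ (maxV v)
    bound v = ≤-trans (proj₂ (majorise dg) _)
      (≤-trans (iter-monotone (Fast-monotone γ) cg (maxV-tabulate≤ _ _ (λ i → ≤-trans (proj₂ (majorise (dhs i)) v)
                   (iter-count-monotone (Fast-inflationary γ) (maxV v) (sumFin-≥ m cs i)))))
               (≤-reflexive (sym (iter-add cg C Φ (maxV v)))))
  majorise (F-lrec h dg dk db e0 es hb) = proj₁ (majorise db) , λ w → ≤-trans (hb w) (proj₂ (majorise db) w)
  majorise (F-ext d e) = proj₁ (majorise d) , λ v → subst (_≤ _) (e v) (proj₂ (majorise d) v)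

+ℕ-≤o : ∀ γ {i j} → i ≤ j → (γ +ℕ i) ≤o (γ +ℕ j)
+ℕ-≤o γ {i} q = go (≤⇒≤′ q)
  where
  go : ∀ {j} → i ≤′ j → (γ +ℕ i) ≤o (γ +ℕ j)
  go ≤′-refl = ≤o-refl (γ +ℕ i)
  go {suc j} (≤′-step q) =
    ≤o-trans (γ +ℕ i) (γ +ℕ j) (suc-o (γ +ℕ j)) (go q) (<o⇒≤o (γ +ℕ j) (suc-o (γ +ℕ j)) (<o-suc-o (γ +ℕ j)))

module Levels (γ : Ord) (cγ : CNF γ) (γ≢𝟎 : γ ≢ 𝟎)
              (f : ℕ → ℕ) (f-mono : ∀ x y → x ≤ y → f x ≤ f y)
              (f∈𝔉 : InF γ 1 (λ v → f (head v))) (f≥ : ∀ x → 1 ⊔ x ≤ f x) where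

  open Greedy f f-mono using (H)

  Φ : ℕ → ℕ → ℕ
  Φ j = Fast (γ +ℕ j)

  f-majorised : Σ ℕ λ c → ∀ x → f x ≤ iter c (Φ 0) x
  f-majorised with Majorise.majorise γ cγ (Fast-twice-doubles γ cγ γ≢𝟎) f∈𝔉
  ... | c , bound = c , λ x → subst (λ z → f x ≤ iter c (Φ 0) z) (⊔-identityʳ x) (bound (x ∷ᵥ []))

  c-f : ℕ
  c-f = proj₁ f-majorised

  f≤ : ∀ j x → f x ≤ iter c-f (Φ j) x
  f≤ j x = ≤-trans (proj₂ f-majorised x) (iter-pointwise (Fast-monotone (γ +ℕ j)) (Fast-+ℕ-≥ γ j) c-f x)

  N∈𝔉 : ∀ j → InF (γ +ℕ j) 1 (λ v → N f (suc j) (head v))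
  N∈𝔉 j = inF-scale (suc j) (inF-∸ (inF-mono (+ℕ-≤o γ {j = j} z≤n) f∈𝔉) (inF-const 1))

  H-Bounded : ℕ → Set
  H-Bounded j = Σ ℕ λ c → InF (γ +ℕ j) 1 (λ v → H (suc j) (head v)) × (∀ x → H (suc j) x ≤ iter c (Φ j) x)

  H₁-bounded : H-Bounded 0
  H₁-bounded = suc (suc c-f) , F-ext (inF-+ (N∈𝔉 0) inF-suc) (λ v → sym (+-is-fold (N f 1 (head v)))) , bound
    where
    open ≤-Reasoning
    bound : ∀ x → H 1 x ≤ iter (suc (suc c-f)) (Φ 0) x
    bound x = begin
      H 1 x                               ≡⟨ +-is-fold (N f 1 x) ⟩
      (f x ∸ 1) + 0 + suc x               ≡⟨ cong (_+ suc x) (+-identityʳ (f x ∸ 1)) ⟩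
      (f x ∸ 1) + suc x                   ≡⟨ +-suc (f x ∸ 1) x ⟩
      suc (f x ∸ 1) + x                   ≡⟨ cong (_+ x) (suc-pred (f x) {{>-nonZero (≤-trans (m≤m⊔n 1 x) (f≥ x))}}) ⟩
      f x + x                             ≤⟨ +-mono-≤ (f≤ 0 x) (iter-inflationary (Fast-inflationary γ) c-f x) ⟩
      iter c-f (Φ 0) x + iter c-f (Φ 0) x ≤⟨ Fast-twice-doubles γ cγ γ≢𝟎 _ ⟩
      iter (suc (suc c-f)) (Φ 0) x        ∎

  -- H (j+2) iterates H (j+1); since H (j+1) ≤ F_{γ+j}^c, the iterates are
  -- bounded by F_{γ+j+1}, so the iteration is a limited recursion.
  H-bounded-step : ∀ j → H-Bounded j → H-Bounded (suc j)
  H-bounded-step j (c , H∈𝔉 , H≤) = suc (suc a) + c-f , H'∈𝔉 , H'≤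
    where
    a : ℕ
    a = c * suc (suc j)
    iterH≤ : ∀ n y → iter n (H (suc j)) y ≤ Φ (suc j) (c * n + y)
    iterH≤ n y = ≤-trans (iter-pointwise (iter-monotone (Fast-monotone (γ +ℕ j)) c) H≤ n y)
      (≤-trans (≤-reflexive (sym (iter-mul n c (Φ j) y)))
      (≤-trans (iter-both-monotone (Fast-monotone (γ +ℕ j)) (Fast-inflationary (γ +ℕ j))
                  (≤-trans (≤-reflexive (*-comm n c)) (≤-trans (m≤m+n (c * n) y) (n≤1+n _))) (m≤n+m y (c * n)))
               (≤-reflexive (sym (Fast-suc-o (γ +ℕ j) (c * n + y))))))
    bound∈𝔉 : InF (γ +ℕ suc j) 2 (λ v → Φ (suc j) (c * lookup v fz + lookup v (fs fz)))
    bound∈𝔉 = inF-comp₁ {g = Φ (suc j)}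
      (F-fast (cnf-+ℕ cγ (suc j)) (≤o-refl (γ +ℕ suc j)) (Φ (suc j)) (Fast-graph (γ +ℕ suc j)))
      (inF-+ (inF-scale c (F-proj fz)) (F-proj (fs fz)))
    iterH∈𝔉 : InF (γ +ℕ suc j) 2 (λ v → iter (lookup v fz) (H (suc j)) (lookup v (fs fz)))
    iterH∈𝔉 = inF-iter-bounded (inF-mono (+ℕ-≤o γ (n≤1+n j)) H∈𝔉) bound∈𝔉 iterH≤
    H'∈𝔉 : InF (γ +ℕ suc j) 1 (λ v → H (suc (suc j)) (head v))
    H'∈𝔉 = inF-comp₂ {g = λ n y → iter n (H (suc j)) y} iterH∈𝔉 (N∈𝔉 (suc j)) inF-suc
    H'≤ : ∀ x → H (suc (suc j)) x ≤ iter (suc (suc a) + c-f) (Φ (suc j)) x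
    H'≤ x = ≤-trans (iterH≤ (N f (suc (suc j)) x) (suc x))
      (≤-trans (Fast-monotone (γ +ℕ suc j) (≤-trans (+-mono-≤ N≤ (s≤s (iter-inflationary (Fast-inflationary (γ +ℕ suc j)) c-f x)))
                                                    (Fast-suc-o-linear (γ +ℕ j) a Y)))
               (≤-reflexive (sym (iter-add (suc (suc a)) c-f (Φ (suc j)) x))))
      where
      Y : ℕ
      Y = iter c-f (Φ (suc j)) x
      N≤ : c * N f (suc (suc j)) x ≤ a * Y
      N≤ = ≤-trans (*-monoʳ-≤ c (*-monoʳ-≤ (suc (suc j)) (≤-trans (m∸n≤m (f x) 1) (f≤ (suc j) x))))
                   (≤-reflexive (sym (*-assoc c (suc (suc j)) Y)))

  H-bounded : ∀ j → H-Bounded j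
  H-bounded zero = H₁-bounded
  H-bounded (suc j) = H-bounded-step j (H-bounded j)

  H∈𝔉 : ∀ j → InF (γ +ℕ j) 1 (λ v → H (suc j) (head v))
  H∈𝔉 j = proj₁ (proj₂ (H-bounded j))

proposition1 : (k r : ℕ) → 1 ≤ k → 1 ≤ r →
    (γ : Ord) → CNF γ → γ ≢ 𝟎 →
    (f : ℕ → ℕ) → (∀ x y → x ≤ y → f x ≤ f y) →
    InF γ 1 (λ v → f (head v)) →
    (∀ x → 1 ⊔ x ≤ f x) →
    Σ (ℕ → ℕ) (λ M → (∀ t → MG f (replicate r k) t (M t)) ×
    InF (γ +ℕ (k ∸ 1)) 1 (λ v → M (head v)))
proposition1 (suc k) r _ _ γ cγ γ≢𝟎 f f-mono f∈𝔉 f≥ =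
    (λ t → iter r (H (suc k)) t ∸ t)
  , M-replicate r (suc k)
  , inF-∸ (inF-iter r (H∈𝔉 k)) inF-id
  where
  open Greedy f f-mono using (H; M-replicate)
  open Levels γ cγ γ≢𝟎 f f-mono f∈𝔉 f≥ using (H∈𝔉)
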